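{- Let $n>k\geq 2$ be integers. Then the complete graph $K_n$ is a $\lfloor (n-1)/2\rfloor$-Hamiltonian-like decomposable graph, and \[ \gamma_{\times k,t}((K_n)_I)=\begin{cases} nk+1 & \text{if } k \text{ and } n \text{ are both odd},\\ nk & \text{otherwise.}\end{cases} \]
   Context: All graphs are finite, simple and undirected. For a graph $G$ without isolated vertices, the inflated graph $G_I$ is obtained as follows: each vertex $x_i$ of $G$ of degree $d(x_i)$ is replaced by a clique $X_i\cong K_{d(x_i)}$ whose vertices are labelled $x_ix_j$, one for each neighbour $x_j$ of $x_i$; and each edge $x_ix_j$ of $G$ is replaced by the edge joining $x_ix_j\in X_i$ to $x_jx_i\in X_j$. For an integer $k\geq1$, a set $S\subseteq V(H)$ is a $k$-tuple total dominating set of a graph $H$ if every vertex of $H$ has at least $k$ neighbours in $S$; $\gamma_{\times k,t}(H)$ denotes the minimum cardinality of such a set. A subgraph of $G$ is Hamiltonian if it contains a cycle through all of its vertices. A Hamiltonian-like decomposition of $G$ is a family of pairwise vertex-disjoint Hamiltonian subgraphs $G_1,\dots,G_t$ with $V(G)=V(G_1)\cup\dots\cup V(G_t)$. For $k\geq1$, $G$ is a $k$-Hamiltonian-like decomposable graph if there are $k$ Hamiltonian-like decompositions $G_1^{(i)},\dots,G_{t_i}^{(i)}$ ($1\leq i\leq k$) of $G$ with chosen Hamiltonian cycles $C_s^{(i)}$ of $G_s^{(i)}$ such that the cycles of any two distinct subgraphs $G_s^{(i)}$, $G_r^{(j)}$ share no edge. -}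

module Defs where

open import Data.Nat using (ℕ; suc; _≤_; _%_)
open import Data.Fin using (Fin)
open import Data.Fin.Properties using () renaming (_≟_ to _≟ᶠ_)
open import Data.List using (List; []; _∷_; _++_; [_]; length; filter; zip; lookup)
open import Data.List.Membership.Propositional using (_∈_)
open import Data.List.Relation.Unary.All using (All)
open import Data.List.Relation.Unary.Unique.Propositional using (Unique)
open import Data.Product using (Σ; ∃; _×_; _,_; proj₁; proj₂)
open import Data.Sum using (_⊎_; inj₁; inj₂)
open import Relation.Nullary using (¬_)
open import Data.Empty using (⊥)
open import Relation.Nullary.Decidable using (_×-dec_; _⊎-dec_; ¬?)
open import Relation.Binary using (Decidable; DecidableEquality)
open import Relation.Binary.PropositionalEquality using (_≡_; _≢_; refl; sym; subst)
open import Function.Bundles using (_⇔_)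

record Graph : Set₁ where
  field
    V      : Set
    Adj    : V → V → Set
    adj?   : Decidable Adj
    Adj-sym    : ∀ {u v} → Adj u v → Adj v u
    Adj-irrefl : ∀ {v} → ¬ Adj v v

open Graph public

K : ℕ → Graph
K n = record
  { V          = Fin n
  ; Adj        = λ i j → i ≢ j
  ; adj?       = λ i j → ¬? (i ≟ᶠ j)
  ; Adj-sym    = λ i≢j j≡i → i≢j (sym j≡i)
  ; Adj-irrefl = λ i≢i → i≢i refl
  }

-- Its vertices are the ordered pairs x_i x_j with x_i x_j an edge of G;
-- the vertex x_i x_j lies in the clique X_i.
--   x_i x_j ~ x_k x_l  iff  (i = k and j ≠ l)   [edge inside the clique X_i]
--                       or  (i = l and j = k)   [the edge replacing x_i x_j ∈ E(G)]

module _ (G : Graph) (_≟V_ : DecidableEquality (V G)) where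
  private
    V' : Set
    V' = Σ (V G × V G) (λ p → Adj G (proj₁ p) (proj₂ p))

    Adj' : V' → V' → Set
    Adj' ((x , y) , _) ((x' , y') , _) =
      (x ≡ x' × y ≢ y') ⊎ (x ≡ y' × y ≡ x')

    adj'? : Decidable Adj'
    adj'? ((x , y) , _) ((x' , y') , _) =
      ((x ≟V x') ×-dec ¬? (y ≟V y')) ⊎-dec ((x ≟V y') ×-dec (y ≟V x'))

    sym' : ∀ {u v} → Adj' u v → Adj' v u
    sym' (inj₁ (refl , ne)) = inj₁ (refl , λ e → ne (sym e))
    sym' (inj₂ (refl , refl)) = inj₂ (refl , refl)

    irrefl' : ∀ {v} → ¬ Adj' v v
    irrefl' (inj₁ (_ , ne)) = ne refl
    irrefl' {(x , y) , a} (inj₂ (refl , _)) = Adj-irrefl G a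

  Inflated : Graph
  Inflated = record
    { V          = V'
    ; Adj        = Adj'
    ; adj?       = adj'?
    ; Adj-sym    = λ {u} {v} → sym' {u} {v}
    ; Adj-irrefl = λ {v} → irrefl' {v}
    }

module _ (G : Graph) where

  rotate : List (V G) → List (V G)
  rotate []       = []
  rotate (x ∷ xs) = xs ++ [ x ]

  cyclicPairs : List (V G) → List (V G × V G)
  cyclicPairs vs = zip vs (rotate vs)

  record Cycle : Set where
    field
      cverts   : List (V G)
      length≥3 : 3 ≤ length cverts
      distinct : Unique cverts
      adjacent : All (λ p → Adj G (proj₁ p) (proj₂ p)) (cyclicPairs cverts)

  open Cycle public

  CycleEdge : Cycle → V G → V G → Set
  CycleEdge C u v = ((u , v) ∈ cyclicPairs (cverts C)) ⊎ ((v , u) ∈ cyclicPairs (cverts C))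

  ShareEdge : Cycle → Cycle → Set
  ShareEdge C D = ∃ λ u → ∃ λ v → CycleEdge C u v × CycleEdge D u v

  record Subgraph : Set₁ where
    field
      VS     : V G → Set
      ES     : V G → V G → Set
      ES-sym : ∀ {u v} → ES u v → ES v u
      ES⊆E   : ∀ {u v} → ES u v → Adj G u v
      ES-ends : ∀ {u v} → ES u v → VS u × VS v

  open Subgraph public

  record HamSubgraph : Set₁ where
    field
      sub       : Subgraph
      hcycle    : Cycle
      cycle-in  : ∀ {u v} → CycleEdge hcycle u v → ES sub u v
      spanning  : ∀ v → VS sub v ⇔ v ∈ cverts hcycle

  open HamSubgraph public

  record HamLikeDecomposition : Set₁ where
    field
      parts    : List HamSubgraph
      disjoint : ∀ (s r : Fin (length parts)) → s ≢ r → ∀ v →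
                 VS (sub (lookup parts s)) v → VS (sub (lookup parts r)) v → ⊥
      covering : ∀ v → ∃ λ (s : Fin (length parts)) → VS (sub (lookup parts s)) v

  open HamLikeDecomposition public

  PartIndex : ∀ {k} → (Fin k → HamLikeDecomposition) → Set
  PartIndex {k} D = Σ (Fin k) (λ i → Fin (length (parts (D i))))

  cycleAt : ∀ {k} (D : Fin k → HamLikeDecomposition) → PartIndex D → Cycle
  cycleAt D (i , s) = hcycle (lookup (parts (D i)) s)

  KHamLikeDecomposable : ℕ → Set₁
  KHamLikeDecomposable k =
    Σ (Fin k → HamLikeDecomposition) λ D →
      ∀ (p q : PartIndex D) → p ≢ q → ¬ ShareEdge (cycleAt D p) (cycleAt D q)

  -- k-tuple total domination.  A vertex set S is a list of distinct vertices.

  nbrsIn : V G → List (V G) → ℕ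
  nbrsIn v S = length (filter (adj? G v) S)

  IsKTupleTotalDom : ℕ → List (V G) → Set
  IsKTupleTotalDom k S = Unique S × (∀ v → k ≤ nbrsIn v S)

  KTupleTotalDomNumber≡ : ℕ → ℕ → Set
  KTupleTotalDomNumber≡ k m =
    (∃ λ S → IsKTupleTotalDom k S × length S ≡ m) ×
    (∀ S → IsKTupleTotalDom k S → m ≤ length S)

Odd : ℕ → Set
Odd m = m % 2 ≡ 1

module Submission where

-- Decomposability (Walecki's construction).  Put the vertices of K_n on the
-- residues modulo N = n - 1 together with a point ∞.  For r < ⌊N/2⌋ the
-- cycle C_r runs from ∞ along the zigzag path r, r+1, r-1, r+2, … back to ∞.
-- Every edge {x , y} of the path has ⌊((x + y) mod N)/2⌋ = r and the edges at
-- ∞ go to r and r + ⌈N/2⌉, so the cycles are pairwise edge-disjoint; each C_r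
-- on its own is a Hamiltonian-like decomposition.
--
-- Domination.  Describe S ⊆ V((K_n)_I) by the multiplicities μ(i,j) of the
-- vertices x_i x_j.  Then x_i x_j has exactly  ∣S ∩ X_i∣ - μ(i,j) + μ(j,i)
-- neighbours in S.  Summing the resulting inequalities over all ordered pairs
-- gives ∣S∣ ≥ n k; equality forces ∣S ∩ X_i∣ = k and μ symmetric, so ∣S∣ is
-- even, which excludes n k when n and k are odd.  Conversely a simple graph H
-- on the vertices of K_n yields S_H = {x_i x_j : ij ∈ E(H)} in which x_i x_j
-- has deg_H(i) neighbours: a k-regular circulant graph gives n k, and for n, k
-- odd a (k+1)-regular circulant graph minus a near-perfect matching gives
-- n k + 1.

open import Defs
open import Data.Nat using (ℕ; zero; suc; _≤_; _<_; _+_; _*_; _∸_; _/_; _%_; z≤n; s≤s; _≤?_; _<?_; ⌊_/2⌋; ⌈_/2⌉; NonZero)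
open import Data.Nat.Properties hiding (_≟_)
open import Data.Nat.Properties using () renaming (_≟_ to _≟ℕ_)
open import Data.Nat.DivMod using (m/n≡1+[m∸n]/n; %-distribˡ-+; %-distribˡ-*; m<n⇒m%n≡m; [m+n]%n≡m%n; m%n<n; n%n≡0; m%n%n≡m%n)
open import Data.Nat.Tactic.RingSolver using (solve-∀)
open import Data.Fin using (Fin; toℕ; fromℕ; fromℕ<; inject₁) renaming (zero to fzero; suc to fsuc)
open import Data.Fin.Properties using (_≟_; toℕ<n; toℕ-injective; toℕ-fromℕ; toℕ-fromℕ<; toℕ-inject₁)
open import Data.Bool using (Bool; true; false; _∧_; _∨_; not; if_then_else_)
open import Data.Bool.Properties using (∨-comm; ∨-identityʳ; ∧-identityʳ; ∧-zeroʳ; not-involutive)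
open import Data.Product using (Σ; ∃; _×_; _,_; proj₁; proj₂)
open import Data.Sum using (_⊎_; inj₁; inj₂)
open import Data.Empty using (⊥; ⊥-elim)
open import Data.Unit using (⊤; tt)
open import Data.List using (List; []; _∷_; _++_; [_]; length; filter; zip; tabulate)
open import Data.List.Properties using (length-tabulate)
open import Data.List.Membership.Propositional using (_∈_)
open import Data.List.Membership.Propositional.Properties using (∈-tabulate⁺)
open import Data.List.Relation.Unary.Any using (here; there)
open import Data.List.Relation.Unary.All as All using (All; []; _∷_)
open import Data.List.Relation.Unary.All.Properties using () renaming (tabulate⁺ to all-tabulate⁺)
open import Data.List.Relation.Unary.AllPairs using (_∷_; [])
open import Data.List.Relation.Unary.Unique.Propositional using (Unique)
open import Data.List.Relation.Unary.Unique.Propositional.Properties using () renaming (tabulate⁺ to unique-tabulate⁺)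
open import Relation.Unary using (Pred; Decidable)
open import Relation.Nullary using (¬_; Dec; yes; no; does)
open import Relation.Nullary.Decidable using (dec-true; dec-false; does-⇔)
open import Relation.Binary.Definitions using (tri<; tri≈; tri>)
open import Relation.Binary.PropositionalEquality hiding ([_])
open import Function.Bundles using (mk⇔)
open import Algebra.Properties.Semiring.Sum +-*-semiring using (sum; sum-syntax; sum-cong-≗; ∑-distrib-+; ∑-comm; *-distribˡ-sum)

bit : Bool → ℕ
bit true  = 1
bit false = 0

⟦_⟧ : ∀ {a} {P : Set a} → Dec P → ℕ
⟦ d ⟧ = bit (does d)

bit≤1 : ∀ b → bit b ≤ 1
bit≤1 true  = s≤s z≤n
bit≤1 false = z≤n

isEven : ℕ → Bool
isEven zero    = true
isEven (suc t) = not (isEven t)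

isEven-double : ∀ u → isEven (u + u) ≡ true
isEven-double zero    = refl
isEven-double (suc u) rewrite +-suc u u | isEven-double u = refl

⌊1+u+u/2⌋≡u : ∀ u → ⌊ suc (u + u) /2⌋ ≡ u
⌊1+u+u/2⌋≡u zero    = refl
⌊1+u+u/2⌋≡u (suc u) rewrite +-suc u u = cong suc (⌊1+u+u/2⌋≡u u)

-- the division in the statement is the library's floor-halving
n/2≡⌊n/2⌋ : ∀ t → t / 2 ≡ ⌊ t /2⌋
n/2≡⌊n/2⌋ zero          = refl
n/2≡⌊n/2⌋ (suc zero)    = refl
n/2≡⌊n/2⌋ (suc (suc t)) = trans (m/n≡1+[m∸n]/n {suc (suc t)} {2} (s≤s (s≤s z≤n))) (cong suc (n/2≡⌊n/2⌋ t))

data Parity : ℕ → Set where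
  even : ∀ u → Parity (u + u)
  odd  : ∀ u → Parity (suc (u + u))

parity : ∀ m → Parity m
parity zero = even 0
parity (suc m) with parity m
... | even u = odd u
... | odd u  = subst Parity (cong suc (+-suc u u)) (even (suc u))

¬Odd-double : ∀ u → ¬ Odd (u + u)
¬Odd-double u u+u-odd = 0≢1+n (trans (sym (double-%2 u)) u+u-odd)
  where
  double-%2 : ∀ u → (u + u) % 2 ≡ 0
  double-%2 zero    = refl
  double-%2 (suc u) rewrite +-suc u u = double-%2 u

Odd-1+double : ∀ u → Odd (suc (u + u))
Odd-1+double u = %-1+double u
  where
  %-1+double : ∀ u → suc (u + u) % 2 ≡ 1
  %-1+double zero    = refl
  %-1+double (suc u) rewrite +-suc u u = %-1+double u

parity-halves : ∀ t → (isEven t ≡ true × t ≡ ⌊ t /2⌋ + ⌊ t /2⌋) ⊎ (isEven t ≡ false × t ≡ suc (⌊ t /2⌋ + ⌊ t /2⌋))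
parity-halves t with parity t
... | even u = inj₁ (isEven-double u , cong (λ z → z + z) (n≡⌊n+n/2⌋ u))
... | odd u  = inj₂ (cong not (isEven-double u) , cong (λ z → suc (z + z)) (sym (⌊1+u+u/2⌋≡u u)))

⌊n/2⌋+⌊n/2⌋≤n : ∀ n → ⌊ n /2⌋ + ⌊ n /2⌋ ≤ n
⌊n/2⌋+⌊n/2⌋≤n n = ≤-trans (+-monoʳ-≤ ⌊ n /2⌋ (⌊n/2⌋≤⌈n/2⌉ n)) (≤-reflexive (⌊n/2⌋+⌈n/2⌉≡n n))

module Rotation (N′ : ℕ) where
  N : ℕ
  N = suc N′

  suc-% : ∀ a → suc a % N ≡ (a % N + 1) % N
  suc-% a = begin
    suc a % N                    ≡⟨ cong (_% N) (+-comm 1 a) ⟩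
    (a + 1) % N                  ≡⟨ %-distribˡ-+ a 1 N ⟩
    (a % N + 1 % N) % N          ≡⟨ cong (λ z → (z + 1 % N) % N) (sym (m%n%n≡m%n a N)) ⟩
    (a % N % N + 1 % N) % N      ≡⟨ sym (%-distribˡ-+ (a % N) 1 N) ⟩
    (a % N + 1) % N              ∎
    where open ≡-Reasoning

  +1-cases : ∀ x → x < N → (suc x < N × (x + 1) % N ≡ suc x) ⊎ (suc x ≡ N × (x + 1) % N ≡ 0)
  +1-cases x x<N with suc x <? N
  ... | yes 1+x<N = inj₁ (1+x<N , trans (cong (_% N) (+-comm x 1)) (m<n⇒m%n≡m 1+x<N))
  ... | no 1+x≮N  = inj₂ (1+x≡N , trans (cong (_% N) (trans (+-comm x 1) 1+x≡N)) (n%n≡0 N))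
    where
    1+x≡N : suc x ≡ N
    1+x≡N = ≤-antisym x<N (≮⇒≥ 1+x≮N)

  +1-injective : ∀ {x y} → x < N → y < N → (x + 1) % N ≡ (y + 1) % N → x ≡ y
  +1-injective {x} {y} x<N y<N eq with +1-cases x x<N | +1-cases y y<N
  ... | inj₁ (_ , ex)    | inj₁ (_ , ey)    = suc-injective (trans (sym ex) (trans eq ey))
  ... | inj₂ (1+x≡N , _) | inj₂ (1+y≡N , _) = suc-injective (trans 1+x≡N (sym 1+y≡N))
  ... | inj₁ (_ , ex)    | inj₂ (_ , ey) with trans (sym ex) (trans eq ey)
  ...   | ()
  +1-injective {x} {y} x<N y<N eq | inj₂ (_ , ex) | inj₁ (_ , ey) with trans (sym ey) (trans (sym eq) ex)
  ...   | ()

  +1-surjective : ∀ x → x < N → ∃ λ x′ → x′ < N × (x′ + 1) % N ≡ x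
  +1-surjective zero    _   = N′ , ≤-refl , trans (cong (_% N) (+-comm N′ 1)) (n%n≡0 N)
  +1-surjective (suc x) x<N = x , <-trans (n<1+n x) x<N , trans (cong (_% N) (+-comm x 1)) (m<n⇒m%n≡m x<N)

  -- rotation by c is the c-fold iterate of x ↦ x + 1 mod N
  rotate-injective : ∀ c {w w′} → w < N → w′ < N → (c + w) % N ≡ (c + w′) % N → w ≡ w′
  rotate-injective zero    {w} {w′} w<N w′<N eq = trans (sym (m<n⇒m%n≡m w<N)) (trans eq (m<n⇒m%n≡m w′<N))
  rotate-injective (suc c) {w} {w′} w<N w′<N eq =
    rotate-injective c w<N w′<N
      (+1-injective (m%n<n (c + w) N) (m%n<n (c + w′) N) (trans (sym (suc-% (c + w))) (trans eq (suc-% (c + w′)))))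

  rotate-surjective : ∀ c x → x < N → ∃ λ w → w < N × (c + w) % N ≡ x
  rotate-surjective zero    x x<N = x , x<N , m<n⇒m%n≡m x<N
  rotate-surjective (suc c) x x<N with +1-surjective x x<N
  ... | x′ , x′<N , x′+1≡x with rotate-surjective c x′ x′<N
  ...   | w , w<N , c+w≡x′ = w , w<N , trans (suc-% (c + w)) (trans (cong (λ z → (z + 1) % N) c+w≡x′) x′+1≡x)

-- The zigzag walk on 0 … M:  h , h+1 , h-1 , h+2 , h-2 , …  with h = ⌊M/2⌋,
-- i.e. w(2u) = h - u and w(2u+1) = h + 1 + u.

module Walk (M : ℕ) where
  h : ℕ
  h = ⌊ M /2⌋

  w : ℕ → ℕ
  w t = if isEven t then h ∸ ⌊ t /2⌋ else suc (h + ⌊ t /2⌋)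

  w-even : ∀ u → w (u + u) ≡ h ∸ u
  w-even u = trans (cong (λ b → if b then h ∸ ⌊ u + u /2⌋ else suc (h + ⌊ u + u /2⌋)) (isEven-double u))
                   (cong (h ∸_) (sym (n≡⌊n+n/2⌋ u)))

  w-odd : ∀ u → w (suc (u + u)) ≡ suc (h + u)
  w-odd u = trans (cong (λ b → if b then h ∸ ⌊ suc (u + u) /2⌋ else suc (h + ⌊ suc (u + u) /2⌋)) (cong not (isEven-double u)))
                  (cong (λ z → suc (h + z)) (⌊1+u+u/2⌋≡u u))

  h+⌈M/2⌉≡M : h + ⌈ M /2⌉ ≡ M
  h+⌈M/2⌉≡M = ⌊n/2⌋+⌈n/2⌉≡n M

  double≤M⇒≤h : ∀ {u} → u + u ≤ M → u ≤ h
  double≤M⇒≤h {u} 2u≤M = subst (_≤ h) (sym (n≡⌊n+n/2⌋ u)) (⌊n/2⌋-mono 2u≤M)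

  1+double≤M⇒<⌈M/2⌉ : ∀ {u} → suc (u + u) ≤ M → u < ⌈ M /2⌉
  1+double≤M⇒<⌈M/2⌉ {u} 2u+1≤M = subst (_≤ ⌈ M /2⌉) (cong suc (sym (n≡⌊n+n/2⌋ u))) (⌊n/2⌋-mono (s≤s 2u+1≤M))

  w≤M : ∀ t → t ≤ M → w t ≤ M
  w≤M t t≤M with parity t
  ... | even u = subst (_≤ M) (sym (w-even u)) (≤-trans (m∸n≤m h u) (⌊n/2⌋≤n M))
  ... | odd u  = subst (_≤ M) (sym (w-odd u))
                   (≤-trans (≤-reflexive (sym (+-suc h u))) (≤-trans (+-monoʳ-≤ h (1+double≤M⇒<⌈M/2⌉ t≤M)) (≤-reflexive h+⌈M/2⌉≡M)))

  -- w is a bijection of 0 … M: the even steps fill h, h-1, …, 0 and the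
  -- odd steps h+1, …, M
  w-injective : ∀ {t t′} → t ≤ M → t′ ≤ M → w t ≡ w t′ → t ≡ t′
  w-injective {t} {t′} t≤M t′≤M eq with parity t | parity t′
  ... | even u | even u′ = cong (λ z → z + z) (∸-cancelˡ-≡ (double≤M⇒≤h {u} t≤M) (double≤M⇒≤h {u′} t′≤M)
                                                 (trans (sym (w-even u)) (trans eq (w-even u′))))
  ... | odd u  | odd u′  = cong (λ z → suc (z + z)) (+-cancelˡ-≡ h u u′ (suc-injective (trans (sym (w-odd u)) (trans eq (w-odd u′)))))
  ... | even u | odd u′  = ⊥-elim (<⇒≱ (s≤s (≤-trans (m∸n≤m h u) (m≤m+n h u′))) (≤-reflexive (trans (sym (w-odd u′)) (trans (sym eq) (w-even u)))))
  ... | odd u  | even u′ = ⊥-elim (<⇒≱ (s≤s (≤-trans (m∸n≤m h u′) (m≤m+n h u))) (≤-reflexive (trans (sym (w-odd u)) (trans eq (w-even u′)))))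

  w-surjective : ∀ y → y ≤ M → ∃ λ t → t ≤ M × w t ≡ y
  w-surjective y y≤M with y ≤? h
  ... | yes y≤h = u + u , ≤-trans (+-mono-≤ (m∸n≤m h y) (m∸n≤m h y)) (⌊n/2⌋+⌊n/2⌋≤n M) ,
                  trans (w-even u) (m∸[m∸n]≡n y≤h)
    where
    u : ℕ
    u = h ∸ y
  ... | no y≰h  = suc (u + u) , 2u+1≤M , trans (w-odd u) (m+[n∸m]≡n h<y)
    where
    u : ℕ
    u = y ∸ suc h
    h<y : suc h ≤ y
    h<y = ≰⇒> y≰h
    1+u≤⌈M/2⌉ : suc u ≤ ⌈ M /2⌉
    1+u≤⌈M/2⌉ = +-cancelˡ-≤ h (suc u) ⌈ M /2⌉
                  (≤-trans (≤-reflexive (trans (+-suc h u) (m+[n∸m]≡n h<y))) (≤-trans y≤M (≤-reflexive (sym h+⌈M/2⌉≡M))))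
    2u+1≤M : suc (u + u) ≤ M
    2u+1≤M = ≤-pred (≤-trans (≤-reflexive (cong suc (sym (+-suc u u))))
                             (≤-trans (+-mono-≤ 1+u≤⌈M/2⌉ 1+u≤⌈M/2⌉) (⌊n/2⌋+⌊n/2⌋≤n (suc M))))

  -- consecutive values: (h - u) + (h + 1 + u) and (h + 1 + u) + (h - u - 1)
  w-consecutive : ∀ t → suc t ≤ M → w t + w (suc t) ≡ bit (isEven t) + (h + h)
  w-consecutive t 1+t≤M with parity t
  ... | even u = begin
    w (u + u) + w (suc (u + u))        ≡⟨ cong₂ _+_ (w-even u) (w-odd u) ⟩
    (h ∸ u) + suc (h + u)              ≡⟨ +-suc (h ∸ u) (h + u) ⟩
    suc ((h ∸ u) + (h + u))            ≡⟨ cong suc (regroup (h ∸ u) h u) ⟩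
    suc (h + ((h ∸ u) + u))            ≡⟨ cong (λ z → suc (h + z)) (m∸n+n≡m (double≤M⇒≤h {u} (≤-trans (n≤1+n (u + u)) 1+t≤M))) ⟩
    suc (h + h)                        ≡⟨ cong (λ b → bit b + (h + h)) (sym (isEven-double u)) ⟩
    bit (isEven (u + u)) + (h + h)     ∎
    where
    open ≡-Reasoning
    regroup : ∀ a h u → a + (h + u) ≡ h + (a + u)
    regroup = solve-∀
  ... | odd u = begin
    w (suc (u + u)) + w (suc (suc (u + u)))  ≡⟨ cong₂ _+_ (w-odd u) (trans (cong w (cong suc (sym (+-suc u u)))) (w-even (suc u))) ⟩
    suc (h + u) + (h ∸ suc u)                ≡⟨ cong (_+ (h ∸ suc u)) (sym (+-suc h u)) ⟩
    (h + suc u) + (h ∸ suc u)                ≡⟨ +-assoc h (suc u) (h ∸ suc u) ⟩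
    h + (suc u + (h ∸ suc u))                ≡⟨ cong (h +_) (m+[n∸m]≡n 1+u≤h) ⟩
    h + h                                    ≡⟨ cong (λ b → bit b + (h + h)) (sym (cong not (isEven-double u))) ⟩
    bit (isEven (suc (u + u))) + (h + h)     ∎
    where
    open ≡-Reasoning
    1+u≤h : suc u ≤ h
    1+u≤h = double≤M⇒≤h (subst (_≤ M) (cong suc (sym (+-suc u u))) 1+t≤M)

-- The zigzag path from r to r + ⌈N/2⌉ through all residues modulo N = M + 1:
-- the walk w rotated so that it starts at r.  For r < ⌊N/2⌋ the sums of
-- consecutive vertices are 2r + 1 and 2r modulo N, so every edge {x , y} of
-- the path has ⌊((x + y) mod N)/2⌋ = r.

module Zigzag (M r : ℕ) (r<⌈M/2⌉ : r < ⌈ M /2⌉) where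
  open Walk M
  open Rotation M

  shift : ℕ
  shift = r + (N ∸ h)

  vertex : ℕ → ℕ
  vertex t = (shift + w t) % N

  vertex<N : ∀ t → vertex t < N
  vertex<N t = m%n<n (shift + w t) N

  vertex-injective : ∀ {t t′} → t ≤ M → t′ ≤ M → vertex t ≡ vertex t′ → t ≡ t′
  vertex-injective t≤M t′≤M eq = w-injective t≤M t′≤M (rotate-injective shift (s≤s (w≤M _ t≤M)) (s≤s (w≤M _ t′≤M)) eq)

  vertex-surjective : ∀ x → x < N → ∃ λ t → t ≤ M × vertex t ≡ x
  vertex-surjective x x<N with rotate-surjective shift x x<N
  ... | y , y<N , shift+y≡x with w-surjective y (≤-pred y<N)
  ...   | t , t≤M , wt≡y = t , t≤M , trans (cong (λ z → (shift + z) % N) wt≡y) shift+y≡x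

  h<N : h < N
  h<N = s≤s (⌊n/2⌋≤n M)

  N∸h+h : (N ∸ h) + h ≡ N
  N∸h+h = m∸n+n≡m (<⇒≤ h<N)

  2r+1<N : suc (r + r) < N
  2r+1<N = ≤-trans (≤-reflexive (cong suc (sym (+-suc r r)))) (≤-trans (+-mono-≤ r<⌈M/2⌉ r<⌈M/2⌉) (⌊n/2⌋+⌊n/2⌋≤n N))

  vertex-consecutive : ∀ t → suc t ≤ M → ⌊ (vertex t + vertex (suc t)) % N /2⌋ ≡ r
  vertex-consecutive t 1+t≤M = trans (cong ⌊_/2⌋ sum≡) (half (isEven t))
    where
    open ≡-Reasoning
    regroup : ∀ r K a b → (r + K + a) + (r + K + b) ≡ (a + b) + (r + r) + (K + K)
    regroup = solve-∀
    regroup′ : ∀ e r K h → (e + (h + h)) + (r + r) + (K + K) ≡ (e + (r + r)) + (K + h) + (K + h)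
    regroup′ = solve-∀
    sum≡ : (vertex t + vertex (suc t)) % N ≡ bit (isEven t) + (r + r)
    sum≡ = begin
      ((shift + w t) % N + (shift + w (suc t)) % N) % N  ≡⟨ sym (%-distribˡ-+ (shift + w t) _ N) ⟩
      ((shift + w t) + (shift + w (suc t))) % N          ≡⟨ cong (_% N) (regroup r (N ∸ h) (w t) (w (suc t))) ⟩
      ((w t + w (suc t)) + (r + r) + ((N ∸ h) + (N ∸ h))) % N
        ≡⟨ cong (λ z → (z + (r + r) + ((N ∸ h) + (N ∸ h))) % N) (w-consecutive t 1+t≤M) ⟩
      ((bit (isEven t) + (h + h)) + (r + r) + ((N ∸ h) + (N ∸ h))) % N
        ≡⟨ cong (_% N) (regroup′ (bit (isEven t)) r (N ∸ h) h) ⟩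
      ((bit (isEven t) + (r + r)) + ((N ∸ h) + h) + ((N ∸ h) + h)) % N
        ≡⟨ cong (λ z → ((bit (isEven t) + (r + r)) + z + z) % N) N∸h+h ⟩
      ((bit (isEven t) + (r + r)) + N + N) % N
        ≡⟨ [m+n]%n≡m%n ((bit (isEven t) + (r + r)) + N) N ⟩
      ((bit (isEven t) + (r + r)) + N) % N
        ≡⟨ [m+n]%n≡m%n (bit (isEven t) + (r + r)) N ⟩
      (bit (isEven t) + (r + r)) % N
        ≡⟨ m<n⇒m%n≡m (≤-<-trans (+-monoˡ-≤ (r + r) (bit≤1 (isEven t))) 2r+1<N) ⟩
      bit (isEven t) + (r + r) ∎
    half : ∀ b → ⌊ bit b + (r + r) /2⌋ ≡ r
    half true  = ⌊1+u+u/2⌋≡u r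
    half false = sym (n≡⌊n+n/2⌋ r)

  vertex-first : vertex 0 ≡ r
  vertex-first = begin
    (r + (N ∸ h) + h) % N    ≡⟨ cong (_% N) (trans (+-assoc r (N ∸ h) h) (cong (r +_) N∸h+h)) ⟩
    (r + N) % N              ≡⟨ [m+n]%n≡m%n r N ⟩
    r % N                    ≡⟨ m<n⇒m%n≡m (<-trans (≤-<-trans (m≤m+n r r) (n<1+n (r + r))) 2r+1<N) ⟩
    r                        ∎
    where open ≡-Reasoning

  -- the path ends at r + ⌈N/2⌉ = r + (1 + h)
  end : ℕ
  end = r + suc h

  end<N : end < N
  end<N = s≤s (≤-trans (≤-reflexive (+-suc r h)) (≤-trans (+-monoˡ-≤ h r<⌈M/2⌉) (≤-reflexive (trans (+-comm ⌈ M /2⌉ h) h+⌈M/2⌉≡M))))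

  vertex-last : vertex M ≡ end
  vertex-last with parity-halves M
  ... | inj₁ (M-even , M≡2h) = begin
    (shift + w M) % N        ≡⟨ cong (λ z → (shift + z) % N) (trans w-M (n∸n≡0 h)) ⟩
    (shift + 0) % N          ≡⟨ cong (_% N) (trans (+-identityʳ shift) (cong (r +_) N∸h≡1+h)) ⟩
    end % N                  ≡⟨ m<n⇒m%n≡m end<N ⟩
    end                      ∎
    where
    open ≡-Reasoning
    w-M : w M ≡ h ∸ h
    w-M = cong (λ b → if b then h ∸ h else suc (h + h)) M-even
    N∸h≡1+h : N ∸ h ≡ suc h
    N∸h≡1+h = trans (cong (λ z → suc z ∸ h) M≡2h) (m+n∸n≡m (suc h) h)
  ... | inj₂ (M-odd , M≡2h+1) = begin
    (shift + w M) % N        ≡⟨ cong (λ z → (shift + z) % N) w-M ⟩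
    (shift + suc (h + h)) % N ≡⟨ cong (λ z → (r + z + suc (h + h)) % N) N∸h≡2+h ⟩
    (r + suc (suc h) + suc (h + h)) % N ≡⟨ cong (_% N) (regroup r h) ⟩
    (end + suc (suc (h + h))) % N ≡⟨ cong (λ z → (end + suc z) % N) (sym M≡2h+1) ⟩
    (end + N) % N            ≡⟨ [m+n]%n≡m%n end N ⟩
    end % N                  ≡⟨ m<n⇒m%n≡m end<N ⟩
    end                      ∎
    where
    open ≡-Reasoning
    w-M : w M ≡ suc (h + h)
    w-M = cong (λ b → if b then h ∸ h else suc (h + h)) M-odd
    N∸h≡2+h : N ∸ h ≡ suc (suc h)
    N∸h≡2+h = trans (cong (λ z → suc z ∸ h) M≡2h+1) (m+n∸n≡m (suc (suc h)) h)
    regroup : ∀ r h → r + suc (suc h) + suc (h + h) ≡ (r + suc h) + suc (suc (h + h))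
    regroup = solve-∀

-- Consecutive pairs of a list; for a list x ∷ ys this is what 'cyclicPairs'
-- produces on the closed walk x ∷ ys ++ [ x ].
consecutive : ∀ {A : Set} → List A → List (A × A)
consecutive (x ∷ y ∷ r) = (x , y) ∷ consecutive (y ∷ r)
consecutive _           = []

zip-rotate≡consecutive : ∀ {A : Set} (x : A) ys z → zip (x ∷ ys) (ys ++ [ z ]) ≡ consecutive (x ∷ ys ++ [ z ])
zip-rotate≡consecutive x []       z = refl
zip-rotate≡consecutive x (y ∷ ys) z = cong ((x , y) ∷_) (zip-rotate≡consecutive y ys z)

all-consecutive : ∀ {A : Set} (P : A × A → Set) {K} (g : Fin (suc K) → A) x z →
  P (x , g fzero) → (∀ (t : Fin K) → P (g (inject₁ t) , g (fsuc t))) → P (g (fromℕ K) , z) →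
  All P (consecutive (x ∷ tabulate g ++ [ z ]))
all-consecutive P {zero}  g x z first middle last = first ∷ last ∷ []
all-consecutive P {suc K} g x z first middle last =
  first ∷ all-consecutive P (λ t → g (fsuc t)) (g fzero) z (middle fzero) (λ t → middle (fsuc t)) last

-- The vertices of K_n, n = N + 1 = M + 2, are the
-- residues 0 … N-1 and a point ∞ = N.  Its edges are
-- {∞ , r}, {∞ , r + ⌈N/2⌉} and pairs {x , y} with ⌊((x + y) mod N)/2⌋ = r,
-- so distinct cycles share no edge.

module Walecki (M : ℕ) (1≤M : 1 ≤ M) where
  N n : ℕ
  N = suc M
  n = suc N
  open Walk M using (h)

  ∞ : Fin n
  ∞ = fromℕ N

  endpoint : ℕ → ℕ → Set
  endpoint r x = x ≡ r ⊎ x ≡ r + suc h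

  ZigzagEdge : ℕ → Fin n → Fin n → Set
  ZigzagEdge r a b = (toℕ a ≡ N × endpoint r (toℕ b))
                   ⊎ (toℕ b ≡ N × endpoint r (toℕ a))
                   ⊎ (toℕ a < N × toℕ b < N × ⌊ (toℕ a + toℕ b) % N /2⌋ ≡ r)

  ZigzagEdge-sym : ∀ {r a b} → ZigzagEdge r a b → ZigzagEdge r b a
  ZigzagEdge-sym (inj₁ e)                 = inj₂ (inj₁ e)
  ZigzagEdge-sym (inj₂ (inj₁ e))          = inj₁ e
  ZigzagEdge-sym {r} {a} {b} (inj₂ (inj₂ (a<N , b<N , sum))) =
    inj₂ (inj₂ (b<N , a<N , trans (cong (λ z → ⌊ z % N /2⌋) (+-comm (toℕ b) (toℕ a))) sum))

  ⌈M/2⌉≤1+h : ⌈ M /2⌉ ≤ suc h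
  ⌈M/2⌉≤1+h = ⌊n/2⌋-mono (n≤1+n (suc M))

  endpoint<N : ∀ {r x} → r < ⌈ M /2⌉ → endpoint r x → x < N
  endpoint<N {r} r<m (inj₁ refl) = <-≤-trans r<m (⌊n/2⌋≤n N)
  endpoint<N {r} r<m (inj₂ refl) = Zigzag.end<N M r r<m

  endpoint-injective : ∀ {r s x} → r < ⌈ M /2⌉ → s < ⌈ M /2⌉ → endpoint r x → endpoint s x → r ≡ s
  endpoint-injective r<m s<m (inj₁ refl) (inj₁ e) = e
  endpoint-injective {r} {s} r<m s<m (inj₁ refl) (inj₂ e) = ⊥-elim (<⇒≱ r<m (≤-trans ⌈M/2⌉≤1+h (≤-trans (m≤n+m (suc h) s) (≤-reflexive (sym e)))))
  endpoint-injective {r} {s} r<m s<m (inj₂ refl) (inj₁ e) = ⊥-elim (<⇒≱ s<m (≤-trans ⌈M/2⌉≤1+h (≤-trans (m≤n+m (suc h) r) (≤-reflexive e))))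
  endpoint-injective r<m s<m (inj₂ refl) (inj₂ e) = +-cancelʳ-≡ _ _ _ e

  ZigzagEdge-unique : ∀ {r s a b} → r < ⌈ M /2⌉ → s < ⌈ M /2⌉ → ZigzagEdge r a b → ZigzagEdge s a b → r ≡ s
  ZigzagEdge-unique r<m s<m (inj₁ (_ , e₁)) (inj₁ (_ , e₂))                   = endpoint-injective r<m s<m e₁ e₂
  ZigzagEdge-unique r<m s<m (inj₂ (inj₁ (_ , e₁))) (inj₂ (inj₁ (_ , e₂)))     = endpoint-injective r<m s<m e₁ e₂
  ZigzagEdge-unique r<m s<m (inj₂ (inj₂ (_ , _ , e₁))) (inj₂ (inj₂ (_ , _ , e₂))) = trans (sym e₁) e₂
  ZigzagEdge-unique r<m s<m (inj₁ (a≡N , e₁)) (inj₂ (inj₁ (b≡N , _)))        = ⊥-elim (<-irrefl b≡N (endpoint<N r<m e₁))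
  ZigzagEdge-unique r<m s<m (inj₂ (inj₁ (b≡N , e₁))) (inj₁ (a≡N , _))        = ⊥-elim (<-irrefl a≡N (endpoint<N r<m e₁))
  ZigzagEdge-unique r<m s<m (inj₁ (a≡N , _)) (inj₂ (inj₂ (a<N , _ , _)))     = ⊥-elim (<-irrefl a≡N a<N)
  ZigzagEdge-unique r<m s<m (inj₂ (inj₁ (b≡N , _))) (inj₂ (inj₂ (_ , b<N , _))) = ⊥-elim (<-irrefl b≡N b<N)
  ZigzagEdge-unique r<m s<m (inj₂ (inj₂ (a<N , _ , _))) (inj₁ (a≡N , _))     = ⊥-elim (<-irrefl a≡N a<N)
  ZigzagEdge-unique r<m s<m (inj₂ (inj₂ (_ , b<N , _))) (inj₂ (inj₁ (b≡N , _))) = ⊥-elim (<-irrefl b≡N b<N)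

  Step : ℕ → Fin n × Fin n → Set
  Step r (a , b) = a ≢ b × ZigzagEdge r a b

  module Cycleᵣ (r : ℕ) (r<m : r < ⌈ M /2⌉) where
    open Zigzag M r r<m using (vertex; vertex<N; vertex-injective; vertex-surjective; vertex-consecutive; vertex-first; vertex-last)

    path : Fin N → Fin n
    path t = fromℕ< (<-trans (vertex<N (toℕ t)) (n<1+n N))

    toℕ-path : ∀ t → toℕ (path t) ≡ vertex (toℕ t)
    toℕ-path t = toℕ-fromℕ< _

    path<N : ∀ t → toℕ (path t) < N
    path<N t = subst (_< N) (sym (toℕ-path t)) (vertex<N (toℕ t))

    ∞≢path : ∀ t → ∞ ≢ path t
    ∞≢path t ∞≡ = <-irrefl (trans (cong toℕ (sym ∞≡)) (toℕ-fromℕ N)) (path<N t)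

    path-injective : ∀ {i j} → path i ≡ path j → i ≡ j
    path-injective {i} {j} eq = toℕ-injective (vertex-injective (≤-pred (toℕ<n i)) (≤-pred (toℕ<n j))
                                  (trans (sym (toℕ-path i)) (trans (cong toℕ eq) (toℕ-path j))))

    vertices : List (Fin n)
    vertices = ∞ ∷ tabulate path

    steps : All (Step r) (cyclicPairs (K n) vertices)
    steps = subst (All (Step r)) (sym (zip-rotate≡consecutive ∞ (tabulate path) ∞))
                  (all-consecutive (Step r) path ∞ ∞ first middle last)
      where
      first : Step r (∞ , path fzero)
      first = ∞≢path fzero , inj₁ (toℕ-fromℕ N , inj₁ (trans (toℕ-path fzero) vertex-first))
      middle : ∀ (t : Fin M) → Step r (path (inject₁ t) , path (fsuc t))
      middle t = (λ eq → 1+n≢n (sym (trans (sym (toℕ-inject₁ t)) (cong toℕ (path-injective eq))))) ,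
                 inj₂ (inj₂ (path<N (inject₁ t) , path<N (fsuc t) ,
                   trans (cong (λ z → ⌊ z % N /2⌋) (cong₂ _+_ (trans (toℕ-path (inject₁ t)) (cong vertex (toℕ-inject₁ t))) (toℕ-path (fsuc t))))
                         (vertex-consecutive (toℕ t) (toℕ<n t))))
      last : Step r (path (fromℕ M) , ∞)
      last = (λ eq → ∞≢path (fromℕ M) (sym eq)) ,
             inj₂ (inj₁ (toℕ-fromℕ N , inj₂ (trans (toℕ-path (fromℕ M)) (trans (cong vertex (toℕ-fromℕ M)) vertex-last))))

    cycle : Cycle (K n)
    cycle = record
      { cverts   = vertices
      ; length≥3 = s≤s (≤-trans (s≤s 1≤M) (≤-reflexive (sym (length-tabulate path))))
      ; distinct = all-tabulate⁺ ∞≢path ∷ unique-tabulate⁺ path-injective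
      ; adjacent = All.map proj₁ steps
      }

    cycle-edge : ∀ {u v} → CycleEdge (K n) cycle u v → u ≢ v × ZigzagEdge r u v
    cycle-edge (inj₁ uv∈) = All.lookup steps uv∈
    cycle-edge (inj₂ vu∈) with All.lookup steps vu∈
    ... | v≢u , edge = (λ u≡v → v≢u (sym u≡v)) , ZigzagEdge-sym edge

    covers : ∀ v → v ∈ vertices
    covers v with toℕ v ≟ℕ N
    ... | yes v≡N = here (toℕ-injective (trans v≡N (sym (toℕ-fromℕ N))))
    ... | no v≢N with vertex-surjective (toℕ v) (≤∧≢⇒< (≤-pred (toℕ<n v)) v≢N)
    ...   | t , t≤M , vertex≡v = there (subst (_∈ tabulate path) path≡v (∈-tabulate⁺ {f = path} (fromℕ< (s≤s t≤M))))
      where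
      path≡v : path (fromℕ< (s≤s t≤M)) ≡ v
      path≡v = toℕ-injective (trans (toℕ-path (fromℕ< (s≤s t≤M))) (trans (cong vertex (toℕ-fromℕ< (s≤s t≤M))) vertex≡v))

    decomposition : HamLikeDecomposition (K n)
    decomposition = record
      { parts    = [ record
          { sub = record
              { VS      = λ _ → ⊤
              ; ES      = CycleEdge (K n) cycle
              ; ES-sym  = λ { (inj₁ e) → inj₂ e ; (inj₂ e) → inj₁ e }
              ; ES⊆E    = λ e → proj₁ (cycle-edge e)
              ; ES-ends = λ _ → tt , tt }
          ; hcycle   = cycle
          ; cycle-in = λ e → e
          ; spanning = λ v → mk⇔ (λ _ → covers v) (λ _ → tt) } ]
      ; disjoint = λ { fzero fzero 0≢0 → ⊥-elim (0≢0 refl) }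
      ; covering = λ v → fzero , tt }

  -- the ⌊N/2⌋ cycles C_r: cycles of distinct decompositions lie in distinct
  -- classes, so they share no edge
  decomposable : KHamLikeDecomposable (K n) (N / 2)
  decomposable = decompositions , edge-disjoint
    where
    r<m : ∀ (i : Fin (N / 2)) → toℕ i < ⌈ M /2⌉
    r<m i = subst (toℕ i <_) (n/2≡⌊n/2⌋ N) (toℕ<n i)
    decompositions : Fin (N / 2) → HamLikeDecomposition (K n)
    decompositions i = Cycleᵣ.decomposition (toℕ i) (r<m i)
    edge-disjoint : ∀ p q → p ≢ q → ¬ ShareEdge (K n) (cycleAt (K n) decompositions p) (cycleAt (K n) decompositions q)
    edge-disjoint (i , fzero) (j , fzero) p≢q (u , v , e₁ , e₂) =
      p≢q (cong (_, fzero) (toℕ-injective (ZigzagEdge-unique (r<m i) (r<m j)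
            (proj₂ (Cycleᵣ.cycle-edge (toℕ i) (r<m i) e₁)) (proj₂ (Cycleᵣ.cycle-edge (toℕ j) (r<m j) e₂)))))

∑-const : ∀ {m} c → ∑[ i < m ] c ≡ m * c
∑-const {zero}  c = refl
∑-const {suc m} c = cong (c +_) (∑-const {m} c)

∑-zero : ∀ {m} (f : Fin m → ℕ) → (∀ i → f i ≡ 0) → sum f ≡ 0
∑-zero {m} f f≡0 = trans (sum-cong-≗ f≡0) (trans (∑-const {m} 0) (*-zeroʳ m))

∑-mono : ∀ {m} {f g : Fin m → ℕ} → (∀ i → f i ≤ g i) → sum f ≤ sum g
∑-mono {zero}  f≤g = z≤n
∑-mono {suc m} f≤g = +-mono-≤ (f≤g fzero) (∑-mono (λ i → f≤g (fsuc i)))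

δ : ∀ {m} → Fin m → Fin m → ℕ
δ a b = ⟦ a ≟ b ⟧

δ-refl : ∀ {m} (a : Fin m) → δ a a ≡ 1
δ-refl a = cong bit (dec-true (a ≟ a) refl)

δ-sym : ∀ {m} (a b : Fin m) → δ a b ≡ δ b a
δ-sym a b = cong bit (does-⇔ (mk⇔ sym sym) (a ≟ b) (b ≟ a))

∑-δ : ∀ {m} (a : Fin m) (f : Fin m → ℕ) → ∑[ i < m ] (δ a i * f i) ≡ f a
∑-δ {suc m} fzero    f = trans (cong₂ _+_ (+-identityʳ (f fzero)) (∑-zero {m} _ (λ _ → refl))) (+-identityʳ (f fzero))
∑-δ {suc m} (fsuc a) f = ∑-δ a (λ i → f (fsuc i))

∑-δ₁ : ∀ {m} (a : Fin m) → ∑[ i < m ] δ i a ≡ 1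
∑-δ₁ {m} a = begin
  ∑[ i < m ] δ i a       ≡⟨ sum-cong-≗ (λ i → trans (δ-sym i a) (sym (*-identityʳ (δ a i)))) ⟩
  ∑[ i < m ] (δ a i * 1) ≡⟨ ∑-δ a (λ _ → 1) ⟩
  1                      ∎
  where open ≡-Reasoning

∑-tight : ∀ {m} {f g : Fin m → ℕ} → (∀ i → f i ≤ g i) → sum f ≡ sum g → ∀ i → f i ≡ g i
∑-tight {suc m} {f} {g} f≤g ∑f≡∑g = pointwise
  where
  head≡ : f fzero ≡ g fzero
  head≡ = ≤-antisym (f≤g fzero)
            (+-cancelʳ-≤ (sum (λ i → f (fsuc i))) (g fzero) (f fzero)
              (≤-trans (+-monoʳ-≤ (g fzero) (∑-mono (λ i → f≤g (fsuc i)))) (≤-reflexive (sym ∑f≡∑g))))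
  pointwise : ∀ i → f i ≡ g i
  pointwise fzero    = head≡
  pointwise (fsuc i) = ∑-tight (λ i → f≤g (fsuc i)) (+-cancelˡ-≡ (f fzero) _ _ (trans ∑f≡∑g (cong (_+ _) (sym head≡)))) i

∑∑-symmetric-even : ∀ {m} (f : Fin m → Fin m → ℕ) → (∀ i j → f i j ≡ f j i) → (∀ i → f i i ≡ 0) →
                    ∃ λ x → ∑[ i < m ] ∑[ j < m ] f i j ≡ x + x
∑∑-symmetric-even {zero}  f f-sym f-diag = 0 , refl
∑∑-symmetric-even {suc m} f f-sym f-diag
  with ∑∑-symmetric-even (λ i j → f (fsuc i) (fsuc j)) (λ i j → f-sym (fsuc i) (fsuc j)) (λ i → f-diag (fsuc i))
... | y , inner = row + y , (begin
    (f fzero fzero + row) + ∑[ i < m ] (f (fsuc i) fzero + ∑[ j < m ] f (fsuc i) (fsuc j))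
      ≡⟨ cong₂ _+_ (cong (_+ row) (f-diag fzero)) (∑-distrib-+ (λ i → f (fsuc i) fzero) _) ⟩
    row + (∑[ i < m ] f (fsuc i) fzero + ∑[ i < m ] ∑[ j < m ] f (fsuc i) (fsuc j))
      ≡⟨ cong₂ (λ a b → row + (a + b)) (sum-cong-≗ (λ i → f-sym (fsuc i) fzero)) inner ⟩
    row + (row + (y + y))
      ≡⟨ rearrange row y ⟩
    (row + y) + (row + y) ∎)
  where
  open ≡-Reasoning
  row : ℕ
  row = ∑[ j < m ] f fzero (fsuc j)
  rearrange : ∀ a y → a + (a + (y + y)) ≡ (a + y) + (a + y)
  rearrange = solve-∀

-- Sums over the range 0 … m-1 of ℕ, used for circulant graphs where
-- vertices are handled as numbers.

sumTo : ℕ → (ℕ → ℕ) → ℕ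
sumTo zero    f = 0
sumTo (suc m) f = f 0 + sumTo m (λ t → f (suc t))

sumTo-Fin : ∀ {m} (g : ℕ → ℕ) → ∑[ i < m ] g (toℕ i) ≡ sumTo m g
sumTo-Fin {zero}  g = refl
sumTo-Fin {suc m} g = cong (g 0 +_) (sumTo-Fin {m} (λ t → g (suc t)))

sumTo-cong : ∀ m {f g : ℕ → ℕ} → (∀ t → t < m → f t ≡ g t) → sumTo m f ≡ sumTo m g
sumTo-cong zero    f≡g = refl
sumTo-cong (suc m) f≡g = cong₂ _+_ (f≡g 0 (s≤s z≤n)) (sumTo-cong m (λ t t<m → f≡g (suc t) (s≤s t<m)))

sumTo-split : ∀ p q (g : ℕ → ℕ) → sumTo (p + q) g ≡ sumTo p g + sumTo q (λ t → g (p + t))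
sumTo-split zero    q g = refl
sumTo-split (suc p) q g = trans (cong (g 0 +_) (sumTo-split p q (λ t → g (suc t)))) (sym (+-assoc (g 0) _ _))

sumTo-const : ∀ m c → sumTo m (λ _ → c) ≡ m * c
sumTo-const zero    c = refl
sumTo-const (suc m) c = cong (c +_) (sumTo-const m c)

sumTo-+ : ∀ m (f g : ℕ → ℕ) → sumTo m (λ t → f t + g t) ≡ sumTo m f + sumTo m g
sumTo-+ zero    f g = refl
sumTo-+ (suc m) f g = trans (cong (f 0 + g 0 +_) (sumTo-+ m (λ t → f (suc t)) (λ t → g (suc t)))) (interchange (f 0) (g 0) _ _)
  where
  interchange : ∀ a b c d → (a + b) + (c + d) ≡ (a + c) + (b + d)
  interchange = solve-∀

sumTo-< : ∀ m u → u ≤ m → sumTo m (λ t → ⟦ t <? u ⟧) ≡ u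
sumTo-< zero    zero    _         = refl
sumTo-< (suc m) zero    _         = sumTo-< m zero z≤n
sumTo-< (suc m) (suc u) (s≤s u≤m) = cong suc (sumTo-< m u u≤m)

sumTo-≡ : ∀ m b → sumTo m (λ t → ⟦ t ≟ℕ b ⟧) ≡ ⟦ b <? m ⟧
sumTo-≡ zero    b       = refl
sumTo-≡ (suc m) zero    = cong suc (sumTo-zero m)
  where
  sumTo-zero : ∀ m → sumTo m (λ t → ⟦ suc t ≟ℕ 0 ⟧) ≡ 0
  sumTo-zero zero    = refl
  sumTo-zero (suc m) = sumTo-zero m
sumTo-≡ (suc m) (suc b) = sumTo-≡ m b

length-filter-∷ : ∀ {A : Set} {ℓ} {P : Pred A ℓ} (P? : Decidable P) x xs →
  length (filter P? (x ∷ xs)) ≡ ⟦ P? x ⟧ + length (filter P? xs)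
length-filter-∷ P? x xs with does (P? x)
... | true  = refl
... | false = refl

-- A vertex is an ordered pair (i , j)
-- with i ≢ j, standing for x_i x_j in the clique X_i.  A vertex list S is
-- described by the multiplicities μ S i j of the pairs (i , j); its trace on
-- the clique X_i has size ∣ S ∣ i.

module InflatedComplete (n : ℕ) where

  Kᵢ : Graph
  Kᵢ = Inflated (K n) _≟_

  Pair : Set
  Pair = V Kᵢ

  μ : List Pair → Fin n → Fin n → ℕ
  μ []                    i j = 0
  μ (((a , b) , _) ∷ S) i j = δ i a * δ j b + μ S i j

  ∣_∣ : List Pair → Fin n → ℕ
  ∣ S ∣ i = ∑[ j < n ] μ S i j

  ∣∣-∷ : ∀ a b p S i → ∣ ((a , b) , p) ∷ S ∣ i ≡ δ i a + ∣ S ∣ i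
  ∣∣-∷ a b p S i = begin
    ∑[ j < n ] (δ i a * δ j b + μ S i j)   ≡⟨ ∑-distrib-+ (λ j → δ i a * δ j b) (μ S i) ⟩
    ∑[ j < n ] (δ i a * δ j b) + ∣ S ∣ i   ≡⟨ cong (_+ ∣ S ∣ i) (sym (*-distribˡ-sum (δ i a) (λ j → δ j b))) ⟩
    δ i a * ∑[ j < n ] δ j b + ∣ S ∣ i     ≡⟨ cong (λ z → δ i a * z + ∣ S ∣ i) (∑-δ₁ b) ⟩
    δ i a * 1 + ∣ S ∣ i                    ≡⟨ cong (_+ ∣ S ∣ i) (*-identityʳ (δ i a)) ⟩
    δ i a + ∣ S ∣ i                        ∎
    where open ≡-Reasoning

  length≡∑∣∣ : ∀ S → length S ≡ ∑[ i < n ] ∣ S ∣ i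
  length≡∑∣∣ []                  = sym (∑-zero {n} _ (λ i → ∑-zero {n} _ (λ j → refl)))
  length≡∑∣∣ (((a , b) , p) ∷ S) = sym (begin
    ∑[ i < n ] ∣ ((a , b) , p) ∷ S ∣ i    ≡⟨ sum-cong-≗ (∣∣-∷ a b p S) ⟩
    ∑[ i < n ] (δ i a + ∣ S ∣ i)          ≡⟨ ∑-distrib-+ (λ i → δ i a) ∣ S ∣ ⟩
    ∑[ i < n ] δ i a + ∑[ i < n ] ∣ S ∣ i ≡⟨ cong₂ _+_ (∑-δ₁ a) (sym (length≡∑∣∣ S)) ⟩
    suc (length S)                        ∎)
    where open ≡-Reasoning

  μ-diag : ∀ S i → μ S i i ≡ 0
  μ-diag []                    i = refl
  μ-diag (((a , b) , a≢b) ∷ S) i with i ≟ a | i ≟ b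
  ... | yes refl | yes refl = ⊥-elim (a≢b refl)
  ... | yes _    | no _     = μ-diag S i
  ... | no _     | _        = μ-diag S i

  -- Local count at x_i x_j for one element w = x_a x_b: w is a neighbour
  -- iff a = i and w ≠ x_i x_j, or w = x_j x_i.  Hence
  --   [w ~ x_i x_j] + [w = x_i x_j] = [a = i] + [w = x_j x_i].
  adjacency-count : ∀ i j a b (i≢j : i ≢ j) (a≢b : a ≢ b) →
    ⟦ adj? Kᵢ ((i , j) , i≢j) ((a , b) , a≢b) ⟧ + δ i a * δ j b ≡ δ i a + δ j a * δ i b
  adjacency-count i j a b i≢j a≢b with i ≟ a | j ≟ b | i ≟ b | j ≟ a
  ... | yes i≡a | _       | yes i≡b | _       = ⊥-elim (a≢b (trans (sym i≡a) i≡b))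
  ... | _       | yes j≡b | _       | yes j≡a = ⊥-elim (a≢b (trans (sym j≡a) j≡b))
  ... | yes i≡a | _       | _       | yes j≡a = ⊥-elim (i≢j (trans i≡a (sym j≡a)))
  ... | _       | yes j≡b | yes i≡b | _       = ⊥-elim (i≢j (trans i≡b (sym j≡b)))
  ... | yes _   | yes _   | no _    | no _    = refl
  ... | yes _   | no _    | no _    | no _    = refl
  ... | no _    | yes _   | no _    | no _    = refl
  ... | no _    | no _    | yes _   | yes _   = refl
  ... | no _    | no _    | yes _   | no _    = refl
  ... | no _    | no _    | no _    | yes _   = refl
  ... | no _    | no _    | no _    | no _    = refl

  neighbour-count : ∀ S i j (i≢j : i ≢ j) →
    nbrsIn Kᵢ ((i , j) , i≢j) S + μ S i j ≡ ∣ S ∣ i + μ S j i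
  neighbour-count []                    i j i≢j = sym (trans (+-identityʳ _) (∑-zero {n} _ (λ _ → refl)))
  neighbour-count (w@((a , b) , a≢b) ∷ S) i j i≢j = begin
    length (filter (adj? Kᵢ v) (w ∷ S)) + (δ i a * δ j b + μ S i j)
      ≡⟨ cong (_+ (δ i a * δ j b + μ S i j)) (length-filter-∷ (adj? Kᵢ v) w S) ⟩
    (⟦ adj? Kᵢ v w ⟧ + nbrsIn Kᵢ v S) + (δ i a * δ j b + μ S i j)
      ≡⟨ interchange ⟦ adj? Kᵢ v w ⟧ _ _ _ ⟩
    (⟦ adj? Kᵢ v w ⟧ + δ i a * δ j b) + (nbrsIn Kᵢ v S + μ S i j)
      ≡⟨ cong₂ _+_ (adjacency-count i j a b i≢j a≢b) (neighbour-count S i j i≢j) ⟩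
    (δ i a + δ j a * δ i b) + (∣ S ∣ i + μ S j i)
      ≡⟨ interchange (δ i a) _ _ _ ⟩
    (δ i a + ∣ S ∣ i) + (δ j a * δ i b + μ S j i)
      ≡⟨ cong (_+ (δ j a * δ i b + μ S j i)) (sym (∣∣-∷ a b a≢b S i)) ⟩
    ∣ w ∷ S ∣ i + μ (w ∷ S) j i ∎
    where
    open ≡-Reasoning
    v : Pair
    v = (i , j) , i≢j
    interchange : ∀ a b c d → (a + b) + (c + d) ≡ (a + c) + (b + d)
    interchange = solve-∀

-- Lower bound: summing  k + μ S i j ≤ ∣ S ∣ i + μ S j i  (neighbour-count and
-- domination at x_i x_j) over all ordered pairs i ≢ j of the n = 1 + n'
-- vertices gives  n n' k + ∣S∣ ≤ n' ∣S∣ + ∣S∣,  i.e.  n k ≤ ∣S∣.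

module DoubleCounting (n' : ℕ) .{{_ : NonZero n'}} where
  open InflatedComplete (suc n')

  offDiag : Fin (suc n') → Fin (suc n') → ℕ → ℕ
  offDiag i j c = if does (i ≟ j) then 0 else c

  ∑-offDiag : ∀ i c → ∑[ j < suc n' ] offDiag i j c ≡ n' * c
  ∑-offDiag i c = +-cancelʳ-≡ c _ _ (begin
    ∑[ j < suc n' ] offDiag i j c + c                                ≡⟨ cong (∑[ j < suc n' ] offDiag i j c +_) (sym (∑-δ i (λ _ → c))) ⟩
    ∑[ j < suc n' ] offDiag i j c + ∑[ j < suc n' ] (δ i j * c)      ≡⟨ sym (∑-distrib-+ (λ j → offDiag i j c) (λ j → δ i j * c)) ⟩
    ∑[ j < suc n' ] (offDiag i j c + δ i j * c)                      ≡⟨ sum-cong-≗ (λ j → split (i ≟ j)) ⟩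
    ∑[ j < suc n' ] c                                                ≡⟨ ∑-const {suc n'} c ⟩
    c + n' * c                                                       ≡⟨ +-comm c _ ⟩
    n' * c + c                                                       ∎)
    where
    open ≡-Reasoning
    split : ∀ {P : Set} (d : Dec P) → (if does d then 0 else c) + bit (does d) * c ≡ c
    split d with does d
    ... | true  = +-identityʳ c
    ... | false = +-identityʳ c

  module _ (k : ℕ) (S : List Pair) (dom : ∀ v → k ≤ nbrsIn Kᵢ v S) where

    lhs rhs : Fin (suc n') → Fin (suc n') → ℕ
    lhs i j = offDiag i j k + μ S i j
    rhs i j = offDiag i j (∣ S ∣ i) + μ S j i

    lhs≤rhs : ∀ i j → lhs i j ≤ rhs i j
    lhs≤rhs i j with i ≟ j
    ... | yes refl = ≤-refl
    ... | no i≢j   = ≤-trans (+-monoˡ-≤ (μ S i j) (dom ((i , j) , i≢j))) (≤-reflexive (neighbour-count S i j i≢j))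

    ∑∑lhs : ∑[ i < suc n' ] ∑[ j < suc n' ] lhs i j ≡ suc n' * (n' * k) + length S
    ∑∑lhs = begin
      ∑[ i < suc n' ] ∑[ j < suc n' ] lhs i j                   ≡⟨ sum-cong-≗ (λ i → ∑-distrib-+ (λ j → offDiag i j k) (μ S i)) ⟩
      ∑[ i < suc n' ] (∑[ j < suc n' ] offDiag i j k + ∣ S ∣ i) ≡⟨ sum-cong-≗ (λ i → cong (_+ ∣ S ∣ i) (∑-offDiag i k)) ⟩
      ∑[ i < suc n' ] (n' * k + ∣ S ∣ i)                        ≡⟨ ∑-distrib-+ (λ _ → n' * k) ∣ S ∣ ⟩
      ∑[ i < suc n' ] (n' * k) + ∑[ i < suc n' ] ∣ S ∣ i        ≡⟨ cong₂ _+_ (∑-const {suc n'} (n' * k)) (sym (length≡∑∣∣ S)) ⟩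
      suc n' * (n' * k) + length S                              ∎
      where open ≡-Reasoning

    ∑∑rhs : ∑[ i < suc n' ] ∑[ j < suc n' ] rhs i j ≡ n' * length S + length S
    ∑∑rhs = begin
      ∑[ i < suc n' ] ∑[ j < suc n' ] rhs i j
        ≡⟨ sum-cong-≗ (λ i → ∑-distrib-+ (λ j → offDiag i j (∣ S ∣ i)) (λ j → μ S j i)) ⟩
      ∑[ i < suc n' ] (∑[ j < suc n' ] offDiag i j (∣ S ∣ i) + ∑[ j < suc n' ] μ S j i)
        ≡⟨ ∑-distrib-+ (λ i → ∑[ j < suc n' ] offDiag i j (∣ S ∣ i)) (λ i → ∑[ j < suc n' ] μ S j i) ⟩
      ∑[ i < suc n' ] ∑[ j < suc n' ] offDiag i j (∣ S ∣ i) + ∑[ i < suc n' ] ∑[ j < suc n' ] μ S j i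
        ≡⟨ cong₂ _+_ (sum-cong-≗ (λ i → ∑-offDiag i (∣ S ∣ i))) (sym (∑-comm (μ S))) ⟩
      ∑[ i < suc n' ] (n' * ∣ S ∣ i) + ∑[ i < suc n' ] ∣ S ∣ i
        ≡⟨ cong (_+ ∑[ i < suc n' ] ∣ S ∣ i) (sym (*-distribˡ-sum n' ∣ S ∣)) ⟩
      n' * ∑[ i < suc n' ] ∣ S ∣ i + ∑[ i < suc n' ] ∣ S ∣ i
        ≡⟨ cong (λ z → n' * z + z) (sym (length≡∑∣∣ S)) ⟩
      n' * length S + length S ∎
      where open ≡-Reasoning

    reorder : suc n' * (n' * k) ≡ n' * (suc n' * k)
    reorder = trans (sym (*-assoc (suc n') n' k)) (trans (cong (_* k) (*-comm (suc n') n')) (*-assoc n' (suc n') k))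

    lower-bound : suc n' * k ≤ length S
    lower-bound = *-cancelˡ-≤ n' (+-cancelʳ-≤ (length S) _ _ (begin
      n' * (suc n' * k) + length S                ≡⟨ cong (_+ length S) (sym reorder) ⟩
      suc n' * (n' * k) + length S                ≡⟨ sym ∑∑lhs ⟩
      ∑[ i < suc n' ] ∑[ j < suc n' ] lhs i j     ≤⟨ ∑-mono (λ i → ∑-mono (lhs≤rhs i)) ⟩
      ∑[ i < suc n' ] ∑[ j < suc n' ] rhs i j     ≡⟨ ∑∑rhs ⟩
      n' * length S + length S                    ∎))
      where open ≤-Reasoning

    tight : length S ≡ suc n' * k → ∀ i j → i ≢ j → k + μ S i j ≡ ∣ S ∣ i + μ S j i
    tight L≡nk i j i≢j with ∑-tight (lhs≤rhs i) (∑-tight (λ i → ∑-mono (lhs≤rhs i)) totals i) j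
      where
      totals : ∑[ i < suc n' ] ∑[ j < suc n' ] lhs i j ≡ ∑[ i < suc n' ] ∑[ j < suc n' ] rhs i j
      totals = begin
        ∑[ i < suc n' ] ∑[ j < suc n' ] lhs i j  ≡⟨ ∑∑lhs ⟩
        suc n' * (n' * k) + length S             ≡⟨ cong₂ _+_ reorder L≡nk ⟩
        n' * (suc n' * k) + suc n' * k           ≡⟨ cong (λ z → n' * z + z) (sym L≡nk) ⟩
        n' * length S + length S                 ≡⟨ sym ∑∑rhs ⟩
        ∑[ i < suc n' ] ∑[ j < suc n' ] rhs i j  ∎
        where open ≡-Reasoning
    ... | lhs≡rhs with i ≟ j
    ...   | yes i≡j = ⊥-elim (i≢j i≡j)
    ...   | no _    = lhs≡rhs

-- With at least three vertices, tightness forces every clique to meet S in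
-- exactly k vertices and μ S to be symmetric, so ∣S∣ = ∑ μ S is even.

ThreeVertices : ℕ → Set
ThreeVertices n = ∀ (i : Fin n) → Σ (Fin n) λ j → Σ (Fin n) λ l → i ≢ j × i ≢ l × j ≢ l

three-vertices : ∀ m → ThreeVertices (3 + m)
three-vertices m fzero           = fsuc fzero , fsuc (fsuc fzero) , (λ ()) , (λ ()) , (λ ())
three-vertices m (fsuc fzero)    = fzero , fsuc (fsuc fzero) , (λ ()) , (λ ()) , (λ ())
three-vertices m (fsuc (fsuc i)) = fzero , fsuc fzero , (λ ()) , (λ ()) , (λ ())

pairwise-sums⇒equal : ∀ x y z k → x + y ≡ k + k → x + z ≡ k + k → y + z ≡ k + k → x ≡ k
pairwise-sums⇒equal x y z k x+y x+z y+z = *-cancelˡ-≡ x k 2 (+-cancelʳ-≡ (y + z) (2 * x) (2 * k) (begin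
  2 * x + (y + z)     ≡⟨ regroup x y z ⟩
  (x + y) + (x + z)   ≡⟨ cong₂ _+_ x+y x+z ⟩
  (k + k) + (k + k)   ≡⟨ cong ((k + k) +_) (sym y+z) ⟩
  (k + k) + (y + z)   ≡⟨ cong (_+ (y + z)) (double k) ⟩
  2 * k + (y + z)     ∎))
  where
  open ≡-Reasoning
  regroup : ∀ x y z → 2 * x + (y + z) ≡ (x + y) + (x + z)
  regroup = solve-∀
  double : ∀ k → k + k ≡ 2 * k
  double = solve-∀

module TightCase (n : ℕ) (three : ThreeVertices n) (k : ℕ) (S : List (InflatedComplete.Pair n))
  (tight : ∀ i j → i ≢ j → k + InflatedComplete.μ n S i j ≡ InflatedComplete.∣_∣ n S i + InflatedComplete.μ n S j i) where
  open InflatedComplete n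

  pair-sum : ∀ i j → i ≢ j → ∣ S ∣ i + ∣ S ∣ j ≡ k + k
  pair-sum i j i≢j = +-cancelʳ-≡ (μ S i j + μ S j i) (∣ S ∣ i + ∣ S ∣ j) (k + k) (begin
    (∣ S ∣ i + ∣ S ∣ j) + (μ S i j + μ S j i)   ≡⟨ shuffle (∣ S ∣ i) (∣ S ∣ j) (μ S i j) (μ S j i) ⟩
    (∣ S ∣ j + μ S i j) + (∣ S ∣ i + μ S j i)   ≡⟨ cong₂ _+_ (sym (tight j i (λ j≡i → i≢j (sym j≡i)))) (sym (tight i j i≢j)) ⟩
    (k + μ S j i) + (k + μ S i j)               ≡⟨ shuffle′ k (μ S j i) (μ S i j) ⟩
    (k + k) + (μ S i j + μ S j i)               ∎)
    where
    open ≡-Reasoning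
    shuffle : ∀ a b c d → (a + b) + (c + d) ≡ (b + c) + (a + d)
    shuffle = solve-∀
    shuffle′ : ∀ k a b → (k + a) + (k + b) ≡ (k + k) + (b + a)
    shuffle′ = solve-∀

  ∣∣≡k : ∀ i → ∣ S ∣ i ≡ k
  ∣∣≡k i with three i
  ... | j , l , i≢j , i≢l , j≢l =
    pairwise-sums⇒equal (∣ S ∣ i) (∣ S ∣ j) (∣ S ∣ l) k (pair-sum i j i≢j) (pair-sum i l i≢l) (pair-sum j l j≢l)

  μ-sym : ∀ i j → μ S i j ≡ μ S j i
  μ-sym i j with i ≟ j
  ... | yes refl = refl
  ... | no i≢j   = +-cancelˡ-≡ k (μ S i j) (μ S j i) (trans (tight i j i≢j) (cong (_+ μ S j i) (∣∣≡k i)))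

  length-even : ∃ λ x → length S ≡ x + x
  length-even with ∑∑-symmetric-even (μ S) μ-sym (μ-diag S)
  ... | x , ∑∑μ≡x+x = x , trans (length≡∑∣∣ S) ∑∑μ≡x+x

-- Lower bounds for γ_{×k,t}((K_n)_I), n = 1 + n′ ≥ 2: at least n k; with
-- three vertices, at least n k + 1 when n and k are both odd (then n k is
-- odd, so ∣S∣ = n k would be odd and even).
lower-bound-nk : ∀ n′ .{{_ : NonZero n′}} k S → IsKTupleTotalDom (InflatedComplete.Kᵢ (suc n′)) k S → suc n′ * k ≤ length S
lower-bound-nk n′ k S (_ , dom) = DoubleCounting.lower-bound n′ k S dom

lower-bound-nk+1 : ∀ n′ .{{_ : NonZero n′}} → ThreeVertices (suc n′) → ∀ k → Odd k → Odd (suc n′) →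
  ∀ S → IsKTupleTotalDom (InflatedComplete.Kᵢ (suc n′)) k S → suc n′ * k + 1 ≤ length S
lower-bound-nk+1 n′ three k k-odd n-odd S (_ , dom) =
  ≤-trans (≤-reflexive (+-comm (suc n′ * k) 1)) (≤∧≢⇒< (DoubleCounting.lower-bound n′ k S dom) attained⇒⊥)
  where
  nk-odd : Odd (suc n′ * k)
  nk-odd = trans (%-distribˡ-* (suc n′) k 2) (cong₂ (λ a b → (a * b) % 2) n-odd k-odd)
  attained⇒⊥ : suc n′ * k ≢ length S
  attained⇒⊥ nk≡L = ¬Odd-double (proj₁ L-even) (subst Odd (trans nk≡L (proj₂ L-even)) nk-odd)
    where
    L-even : ∃ λ x → length S ≡ x + x
    L-even = TightCase.length-even (suc n′) three k S (DoubleCounting.tight n′ k S dom (sym nk≡L))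

-- Upper bounds come from simple graphs H on the vertex set of K_n: taking
-- S_H = { x_i x_j : ij ∈ E(H) } (each ordered pair once), the vertex x_i x_j
-- has exactly deg_H(i) neighbours in S_H, by neighbour-count and symmetry.

module FromGraph (n : ℕ) where
  open InflatedComplete n

  concatFin : ∀ {m} → (Fin m → List Pair) → List Pair
  concatFin {zero}  f = []
  concatFin {suc m} f = f fzero ++ concatFin (λ i → f (fsuc i))

  μ-++ : ∀ S S′ a b → μ (S ++ S′) a b ≡ μ S a b + μ S′ a b
  μ-++ []                    S′ a b = refl
  μ-++ (((x , y) , _) ∷ S) S′ a b = trans (cong (δ a x * δ b y +_) (μ-++ S S′ a b)) (sym (+-assoc (δ a x * δ b y) _ _))

  μ-concatFin : ∀ {m} (f : Fin m → List Pair) a b → μ (concatFin f) a b ≡ ∑[ x < m ] μ (f x) a b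
  μ-concatFin {zero}  f a b = refl
  μ-concatFin {suc m} f a b = trans (μ-++ (f fzero) _ a b) (cong (μ (f fzero) a b +_) (μ-concatFin (λ i → f (fsuc i)) a b))

  ∈⇒μ≥1 : ∀ {S} {w : Pair} → w ∈ S → 1 ≤ μ S (proj₁ (proj₁ w)) (proj₂ (proj₁ w))
  ∈⇒μ≥1 {_} {(a , b) , _} (here refl) = ≤-trans (≤-reflexive (sym (cong₂ _*_ (δ-refl a) (δ-refl b)))) (m≤m+n _ _)
  ∈⇒μ≥1 {((x , y) , _) ∷ S} (there w∈S) = ≤-trans (∈⇒μ≥1 w∈S) (m≤n+m _ _)

  μ≤1⇒Unique : ∀ S → (∀ a b → μ S a b ≤ 1) → Unique S
  μ≤1⇒Unique []                    μ≤1 = []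
  μ≤1⇒Unique (w@((a , b) , _) ∷ S) μ≤1 = All.tabulate w∉S ∷ μ≤1⇒Unique S (λ x y → ≤-trans (m≤n+m _ _) (μ≤1 x y))
    where
    w∉S : ∀ {v} → v ∈ S → w ≢ v
    w∉S v∈S refl = 1+n≰n (≤-trans (+-mono-≤ (≤-reflexive (sym (cong₂ _*_ (δ-refl a) (δ-refl b)))) (∈⇒μ≥1 v∈S)) (μ≤1 a b))

  module _ (H : Fin n → Fin n → Bool) (loopless : ∀ i → H i i ≡ false) where

    edgeList : Fin n → Fin n → List Pair
    edgeList i j with i ≟ j | H i j
    ... | no i≢j | true = [ (i , j) , i≢j ]
    ... | _      | _    = []

    μ-edgeList : ∀ i j a b → μ (edgeList i j) a b ≡ δ a i * (δ b j * bit (H i j))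
    μ-edgeList i j a b with i ≟ j | H i j in Hij
    ... | no _     | true  = trans (+-identityʳ _) (cong (δ a i *_) (sym (*-identityʳ (δ b j))))
    ... | no _     | false = sym (trans (cong (δ a i *_) (*-zeroʳ (δ b j))) (*-zeroʳ (δ a i)))
    ... | yes refl | false = sym (trans (cong (δ a i *_) (*-zeroʳ (δ b j))) (*-zeroʳ (δ a i)))
    ... | yes refl | true  with trans (sym Hij) (loopless i)
    ...   | ()

    S_H : List Pair
    S_H = concatFin (λ i → concatFin (edgeList i))

    μ-S_H : ∀ a b → μ S_H a b ≡ bit (H a b)
    μ-S_H a b = begin
      μ S_H a b                                          ≡⟨ μ-concatFin {n} _ a b ⟩
      ∑[ i < n ] μ (concatFin (edgeList i)) a b          ≡⟨ sum-cong-≗ (λ i → μ-concatFin (edgeList i) a b) ⟩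
      ∑[ i < n ] ∑[ j < n ] μ (edgeList i j) a b         ≡⟨ sum-cong-≗ (λ i → sum-cong-≗ (λ j → μ-edgeList i j a b)) ⟩
      ∑[ i < n ] ∑[ j < n ] (δ a i * (δ b j * bit (H i j))) ≡⟨ sum-cong-≗ (λ i → sym (*-distribˡ-sum (δ a i) (λ j → δ b j * bit (H i j)))) ⟩
      ∑[ i < n ] (δ a i * ∑[ j < n ] (δ b j * bit (H i j))) ≡⟨ ∑-δ a _ ⟩
      ∑[ j < n ] (δ b j * bit (H a j))                   ≡⟨ ∑-δ b _ ⟩
      bit (H a b)                                        ∎
      where open ≡-Reasoning

    S_H-unique : Unique S_H
    S_H-unique = μ≤1⇒Unique S_H (λ a b → ≤-trans (≤-reflexive (μ-S_H a b)) (bit≤1 (H a b)))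

    length-S_H : length S_H ≡ ∑[ i < n ] ∑[ j < n ] bit (H i j)
    length-S_H = trans (length≡∑∣∣ S_H) (sum-cong-≗ (λ i → sum-cong-≗ (μ-S_H i)))

    nbrs-S_H : (∀ i j → H i j ≡ H j i) → ∀ i j (i≢j : i ≢ j) → nbrsIn Kᵢ ((i , j) , i≢j) S_H ≡ ∑[ l < n ] bit (H i l)
    nbrs-S_H symmetric i j i≢j = +-cancelʳ-≡ (μ S_H i j) _ _ (begin
      nbrsIn Kᵢ ((i , j) , i≢j) S_H + μ S_H i j   ≡⟨ neighbour-count S_H i j i≢j ⟩
      ∣ S_H ∣ i + μ S_H j i                       ≡⟨ cong₂ _+_ (sum-cong-≗ (μ-S_H i)) (μ-S_H j i) ⟩
      ∑[ l < n ] bit (H i l) + bit (H j i)        ≡⟨ cong (λ z → ∑[ l < n ] bit (H i l) + bit z) (symmetric j i) ⟩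
      ∑[ l < n ] bit (H i l) + bit (H i j)        ≡⟨ cong (∑[ l < n ] bit (H i l) +_) (sym (μ-S_H i j)) ⟩
      ∑[ l < n ] bit (H i l) + μ S_H i j          ∎)
      where open ≡-Reasoning

Dominating : ℕ → ℕ → ℕ → Set
Dominating n k s = ∃ λ S → IsKTupleTotalDom (Inflated (K n) _≟_) k S × length S ≡ s

graph⇒dominating : ∀ n k d (H : ℕ → ℕ → Bool) →
  (∀ x → H x x ≡ false) →
  (∀ x y → x < n → y < n → x ≢ y → H x y ≡ H y x) →
  (∀ x → x < n → k ≤ sumTo n (λ y → bit (H x y))) →
  sumTo n (λ x → sumTo n (λ y → bit (H x y))) ≡ d →
  Dominating n k d
graph⇒dominating n k d H loopless symmetric min-degree degree-sum =
  S_H Hᶠ (λ i → loopless (toℕ i)) ,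
  (S_H-unique Hᶠ (λ i → loopless (toℕ i)) , dominating) ,
  trans (length-S_H Hᶠ (λ i → loopless (toℕ i))) total
  where
  open FromGraph n
  Hᶠ : Fin n → Fin n → Bool
  Hᶠ i j = H (toℕ i) (toℕ j)

  symmetricᶠ : ∀ i j → Hᶠ i j ≡ Hᶠ j i
  symmetricᶠ i j with i ≟ j
  ... | yes refl = refl
  ... | no i≢j   = symmetric (toℕ i) (toℕ j) (toℕ<n i) (toℕ<n j) (λ e → i≢j (toℕ-injective e))

  degreeᶠ : ∀ i → ∑[ l < n ] bit (Hᶠ i l) ≡ sumTo n (λ y → bit (H (toℕ i) y))
  degreeᶠ i = sumTo-Fin {n} (λ y → bit (H (toℕ i) y))

  dominating : ∀ v → k ≤ nbrsIn (InflatedComplete.Kᵢ n) v (S_H Hᶠ (λ i → loopless (toℕ i)))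
  dominating ((i , j) , i≢j) =
    ≤-trans (min-degree (toℕ i) (toℕ<n i))
            (≤-reflexive (sym (trans (nbrs-S_H Hᶠ (λ i → loopless (toℕ i)) symmetricᶠ i j i≢j) (degreeᶠ i))))

  total : ∑[ i < n ] ∑[ j < n ] bit (Hᶠ i j) ≡ d
  total = trans (sum-cong-≗ degreeᶠ) (trans (sumTo-Fin {n} (λ x → sumTo n (λ y → bit (H x y)))) degree-sum)

module Circulant (n : ℕ) where

  -- the residue of y - x modulo n, for x , y < n
  dist : ℕ → ℕ → ℕ
  dist x y = if does (x ≤? y) then y ∸ x else (n + y) ∸ x

  dist-≤ : ∀ {x y} → x ≤ y → dist x y ≡ y ∸ x
  dist-≤ {x} {y} x≤y rewrite dec-true (x ≤? y) x≤y = refl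

  dist-> : ∀ {x y} → y < x → dist x y ≡ (n + y) ∸ x
  dist-> {x} {y} y<x rewrite dec-false (x ≤? y) (<⇒≱ y<x) = refl

  dist-self : ∀ x → dist x x ≡ 0
  dist-self x = trans (dist-≤ {x} ≤-refl) (n∸n≡0 x)

  -- y ↦ dist x y permutes 0 … n-1
  ∑-dist : ∀ x → x ≤ n → ∀ (f : ℕ → ℕ) → sumTo n (λ y → f (dist x y)) ≡ sumTo n f
  ∑-dist x x≤n f = begin
    sumTo n (λ y → f (dist x y))                                    ≡⟨ cong (λ z → sumTo z (λ y → f (dist x y))) (sym (m+[n∸m]≡n x≤n)) ⟩
    sumTo (x + (n ∸ x)) (λ y → f (dist x y))                        ≡⟨ sumTo-split x (n ∸ x) _ ⟩
    sumTo x (λ y → f (dist x y)) + sumTo (n ∸ x) (λ t → f (dist x (x + t)))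
      ≡⟨ cong₂ _+_ (sumTo-cong x (λ y y<x → cong f (trans (dist-> y<x) (+-∸-comm y x≤n))))
                   (sumTo-cong (n ∸ x) (λ t _ → cong f (trans (dist-≤ (m≤m+n x t)) (m+n∸m≡n x t)))) ⟩
    sumTo x (λ y → f ((n ∸ x) + y)) + sumTo (n ∸ x) f               ≡⟨ +-comm (sumTo x (λ y → f ((n ∸ x) + y))) _ ⟩
    sumTo (n ∸ x) f + sumTo x (λ y → f ((n ∸ x) + y))               ≡⟨ sym (sumTo-split (n ∸ x) x f) ⟩
    sumTo ((n ∸ x) + x) f                                           ≡⟨ cong (λ z → sumTo z f) (m∸n+n≡m x≤n) ⟩
    sumTo n f                                                       ∎
    where open ≡-Reasoning

  private
    wrap : ∀ {x y} → x < y → y < n → (n + x) ∸ y ≡ n ∸ (y ∸ x) × 1 ≤ y ∸ x × y ∸ x < n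
    wrap {x} {y} x<y y<n =
      trans (cong₂ _∸_ (+-comm n x) (sym (m+[n∸m]≡n (<⇒≤ x<y)))) ([m+n]∸[m+o]≡n∸o x n (y ∸ x)) ,
      m<n⇒0<n∸m x<y , ≤-<-trans (m∸n≤m y x) y<n

    complement : ∀ {d} → 1 ≤ d → d < n → 1 ≤ n ∸ d × n ∸ d < n
    complement {d} 1≤d d<n = m<n⇒0<n∸m d<n , ∸-monoʳ-< 1≤d (<⇒≤ d<n)

  dist-flip : ∀ {x y} → x < n → y < n → x ≢ y → 1 ≤ dist x y × dist x y < n × dist y x ≡ n ∸ dist x y
  dist-flip {x} {y} x<n y<n x≢y with <-cmp x y
  ... | tri≈ _ x≡y _ = ⊥-elim (x≢y x≡y)
  ... | tri< x<y _ _ with wrap x<y y<n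
  ...   | dyx , 1≤d , d<n = subst (1 ≤_) (sym dxy) 1≤d , subst (_< n) (sym dxy) d<n ,
                            trans (dist-> x<y) (trans dyx (cong (n ∸_) (sym dxy)))
    where
    dxy : dist x y ≡ y ∸ x
    dxy = dist-≤ (<⇒≤ x<y)
  dist-flip {x} {y} x<n y<n x≢y | tri> _ _ y<x with wrap y<x x<n
  ...   | dxy′ , 1≤d , d<n with complement 1≤d d<n
  ...     | 1≤n-d , n-d<n = subst (1 ≤_) (sym dxy) 1≤n-d , subst (_< n) (sym dxy) n-d<n ,
                            trans (dist-≤ (<⇒≤ y<x)) (trans (sym (m∸[m∸n]≡n (<⇒≤ d<n))) (cong (n ∸_) (sym dxy)))
    where
    dxy : dist x y ≡ n ∸ (x ∸ y)
    dxy = trans (dist-> y<x) dxy′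

  module Connection (C : ℕ → Bool) (C-0 : C 0 ≡ false) (C-sym : ∀ e → 1 ≤ e → e < n → C (n ∸ e) ≡ C e) where

    edge : ℕ → ℕ → Bool
    edge x y = C (dist x y)

    edge-loopless : ∀ x → edge x x ≡ false
    edge-loopless x = trans (cong C (dist-self x)) C-0

    edge-sym : ∀ x y → x < n → y < n → x ≢ y → edge x y ≡ edge y x
    edge-sym x y x<n y<n x≢y with dist-flip x<n y<n x≢y
    ... | 1≤d , d<n , dyx = sym (trans (cong C dyx) (C-sym (dist x y) 1≤d d<n))

    degree : ∀ x → x < n → sumTo n (λ y → bit (edge x y)) ≡ sumTo n (λ e → bit (C e))
    degree x x<n = ∑-dist x (<⇒≤ x<n) (λ e → bit (C e))

true-witness : ∀ {P : Set} (d : Dec P) → does d ≡ true → P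
true-witness (yes p) _ = p

∧-true : ∀ {x y} → x ∧ y ≡ true → x ≡ true × y ≡ true
∧-true {true} {true} _ = refl , refl

∨-true : ∀ {x y} → x ∨ y ≡ true → x ≡ true ⊎ y ≡ true
∨-true {true}  _ = inj₁ refl
∨-true {false} e = inj₂ e

bit-∨ : ∀ x y → (x ≡ true → y ≡ false) → bit (x ∨ y) ≡ bit x + bit y
bit-∨ true  true  excl with excl refl
... | ()
bit-∨ true  false excl = refl
bit-∨ false y     excl = refl

bit-remove : ∀ h m → (m ≡ true → h ≡ true) → bit (h ∧ not m) + bit m ≡ bit h
bit-remove h false _   = trans (+-identityʳ _) (cong bit (∧-identityʳ h))
bit-remove h true  m⇒h rewrite m⇒h refl = refl

-- The interval connection set  {1, …, a} ∪ {n-a, …, n-1}  (∪ {n/2} if c),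
-- for 2a < n: symmetric, and of size 2a (+ 1 if c and n is even).

module Interval (n a : ℕ) (c : Bool) (2a<n : a + a < n) where
  low high mid conn : ℕ → Bool
  low e  = does (1 ≤? e) ∧ does (e ≤? a)
  high e = does (n ∸ a ≤? e)
  mid e  = c ∧ does (e ≟ℕ n ∸ e)
  conn e = low e ∨ (high e ∨ mid e)

  a≤n : a ≤ n
  a≤n = ≤-trans (m≤m+n a a) (<⇒≤ 2a<n)

  1≤n : 1 ≤ n
  1≤n = ≤-trans (s≤s z≤n) 2a<n

  not-2a≥n : ¬ (n ≤ a + a)
  not-2a≥n = <⇒≱ 2a<n

  halves : ∀ {e} → e ≡ n ∸ e → e + e ≡ n
  halves {e} e≡n-e with e ≤? n
  ... | yes e≤n = trans (cong (_+ e) e≡n-e) (m∸n+n≡m e≤n)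
  ... | no e≰n  = ⊥-elim (e≰n (≤-trans (≤-reflexive e≡n-e) (m∸n≤m n e)))

  high⇒n≤a+e : ∀ {e} → high e ≡ true → n ≤ a + e
  high⇒n≤a+e {e} h = ≤-trans (m≤n+m∸n n a) (+-monoʳ-≤ a (true-witness (n ∸ a ≤? e) h))

  low⇒≤a : ∀ {e} → low e ≡ true → e ≤ a
  low⇒≤a {e} l = true-witness (e ≤? a) (proj₂ (∧-true l))

  low⇒¬high : ∀ e → low e ≡ true → high e ≡ false
  low⇒¬high e l with high e in h
  ... | false = refl
  ... | true  = ⊥-elim (not-2a≥n (≤-trans (high⇒n≤a+e h) (+-monoʳ-≤ a (low⇒≤a l))))

  mid⇒¬small : ∀ e → mid e ≡ true → e ≤ a → ⊥
  mid⇒¬small e m e≤a = not-2a≥n (≤-trans (≤-reflexive (sym (halves (true-witness (e ≟ℕ n ∸ e) (proj₂ (∧-true {c} m))))))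
                                         (+-mono-≤ e≤a e≤a))

  low⇒¬mid : ∀ e → low e ≡ true → mid e ≡ false
  low⇒¬mid e l with mid e in m
  ... | false = refl
  ... | true  = ⊥-elim (mid⇒¬small e m (low⇒≤a l))

  high⇒¬mid : ∀ e → high e ≡ true → mid e ≡ false
  high⇒¬mid e h with mid e in m
  ... | false = refl
  ... | true  = ⊥-elim (mid⇒¬small e m (+-cancelˡ-≤ e e a e+e≤e+a))
    where
    e+e≤e+a : e + e ≤ e + a
    e+e≤e+a = ≤-trans (≤-reflexive (halves (true-witness (e ≟ℕ n ∸ e) (proj₂ (∧-true {c} m)))))
                      (≤-trans (high⇒n≤a+e h) (≤-reflexive (+-comm a e)))

  bit-conn : ∀ e → bit (conn e) ≡ bit (low e) + (bit (high e) + bit (mid e))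
  bit-conn e with low e in l
  ... | true  = cong suc (sym (cong₂ (λ x y → bit x + bit y) (low⇒¬high e l) (low⇒¬mid e l)))
  ... | false = bit-∨ (high e) (mid e) (high⇒¬mid e)

  ∣low∣ : sumTo n (λ e → bit (low e)) ≡ a
  ∣low∣ = +-cancelʳ-≡ 1 _ _ (begin
    sumTo n (λ e → bit (low e)) + 1                                  ≡⟨ cong (sumTo n (λ e → bit (low e)) +_) (sym (sumTo-< n 1 1≤n)) ⟩
    sumTo n (λ e → bit (low e)) + sumTo n (λ e → ⟦ e <? 1 ⟧)         ≡⟨ sym (sumTo-+ n _ _) ⟩
    sumTo n (λ e → bit (low e) + ⟦ e <? 1 ⟧)                         ≡⟨ sumTo-cong n (λ e _ → low+zero e) ⟩
    sumTo n (λ e → ⟦ e <? suc a ⟧)                                   ≡⟨ sumTo-< n (suc a) (≤-trans (s≤s (m≤m+n a a)) 2a<n) ⟩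
    suc a                                                            ≡⟨ +-comm 1 a ⟩
    a + 1                                                            ∎)
    where
    open ≡-Reasoning
    low+zero : ∀ e → bit (low e) + ⟦ e <? 1 ⟧ ≡ ⟦ e <? suc a ⟧
    low+zero zero    = refl
    low+zero (suc e) = +-identityʳ _

  ∣high∣ : sumTo n (λ e → bit (high e)) ≡ a
  ∣high∣ = +-cancelʳ-≡ (n ∸ a) _ _ (begin
    sumTo n (λ e → bit (high e)) + (n ∸ a)                           ≡⟨ cong (sumTo n (λ e → bit (high e)) +_) (sym (sumTo-< n (n ∸ a) (m∸n≤m n a))) ⟩
    sumTo n (λ e → bit (high e)) + sumTo n (λ e → ⟦ e <? n ∸ a ⟧)    ≡⟨ sym (sumTo-+ n _ _) ⟩
    sumTo n (λ e → bit (high e) + ⟦ e <? n ∸ a ⟧)                    ≡⟨ sumTo-cong n (λ e _ → high+below e) ⟩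
    sumTo n (λ _ → 1)                                                ≡⟨ trans (sumTo-const n 1) (*-identityʳ n) ⟩
    n                                                                ≡⟨ sym (m+[n∸m]≡n a≤n) ⟩
    a + (n ∸ a)                                                      ∎)
    where
    open ≡-Reasoning
    high+below : ∀ e → bit (high e) + ⟦ e <? n ∸ a ⟧ ≡ 1
    high+below e with n ∸ a ≤? e
    ... | yes n-a≤e = cong₂ _+_ (cong bit (dec-true (n ∸ a ≤? e) n-a≤e)) (cong bit (dec-false (e <? n ∸ a) (≤⇒≯ n-a≤e)))
    ... | no n-a≰e  = cong₂ _+_ (cong bit (dec-false (n ∸ a ≤? e) n-a≰e)) (cong bit (dec-true (e <? n ∸ a) (≰⇒> n-a≰e)))

  ∣mid∣-false : c ≡ false → sumTo n (λ e → bit (mid e)) ≡ 0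
  ∣mid∣-false refl = trans (sumTo-const n 0) (*-zeroʳ n)

  ∣mid∣-true : c ≡ true → ∀ b → n ≡ b + b → sumTo n (λ e → bit (mid e)) ≡ 1
  ∣mid∣-true refl b n≡b+b =
    trans (sumTo-cong n (λ e _ → cong bit (does-⇔ (mk⇔ to from) (e ≟ℕ n ∸ e) (e ≟ℕ b))))
          (trans (sumTo-≡ n b) (cong bit (dec-true (b <? n) b<n)))
    where
    b<n : b < n
    b<n = subst (b <_) (sym n≡b+b) (m<m+n b (positive b (subst (1 ≤_) n≡b+b 1≤n)))
      where
      positive : ∀ b → 1 ≤ b + b → 1 ≤ b
      positive (suc b) _ = s≤s z≤n
    to : ∀ {e} → e ≡ n ∸ e → e ≡ b
    to {e} e≡n-e = *-cancelˡ-≡ e b 2 (trans (cong (e +_) (+-identityʳ e))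
                     (trans (trans (halves e≡n-e) n≡b+b) (cong (b +_) (sym (+-identityʳ b)))))
    from : ∀ {e} → e ≡ b → e ≡ n ∸ e
    from refl = sym (trans (cong (_∸ b) n≡b+b) (m+n∸n≡m b b))

  ∣conn∣ : ∀ t → sumTo n (λ e → bit (mid e)) ≡ t → sumTo n (λ e → bit (conn e)) ≡ a + (a + t)
  ∣conn∣ t ∣mid∣≡t = begin
    sumTo n (λ e → bit (conn e))                                          ≡⟨ sumTo-cong n (λ e _ → bit-conn e) ⟩
    sumTo n (λ e → bit (low e) + (bit (high e) + bit (mid e)))            ≡⟨ sumTo-+ n _ _ ⟩
    sumTo n (λ e → bit (low e)) + sumTo n (λ e → bit (high e) + bit (mid e))
      ≡⟨ cong (sumTo n (λ e → bit (low e)) +_) (sumTo-+ n (λ e → bit (high e)) (λ e → bit (mid e))) ⟩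
    sumTo n (λ e → bit (low e)) + (sumTo n (λ e → bit (high e)) + sumTo n (λ e → bit (mid e)))
      ≡⟨ cong₂ (λ x y → x + (y + sumTo n (λ e → bit (mid e)))) ∣low∣ ∣high∣ ⟩
    a + (a + sumTo n (λ e → bit (mid e)))                                 ≡⟨ cong (λ z → a + (a + z)) ∣mid∣≡t ⟩
    a + (a + t)                                                           ∎
    where open ≡-Reasoning

  conn-0 : conn 0 ≡ false
  conn-0 = cong₂ _∨_ (dec-false (n ∸ a ≤? 0) (<⇒≱ (m<n⇒0<n∸m (≤-<-trans (m≤m+n a a) 2a<n))))
                     (trans (cong (c ∧_) (dec-false (0 ≟ℕ n ∸ 0) (λ 0≡n → <⇒≢ 1≤n 0≡n))) (∧-zeroʳ c))

  -- e ↦ n - e exchanges low and high and fixes mid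
  conn-sym : ∀ e → 1 ≤ e → e < n → conn (n ∸ e) ≡ conn e
  conn-sym e 1≤e e<n = trans (cong₂ _∨_ low↦high (cong₂ _∨_ high↦low mid↦mid)) (swap (low e) (high e) (mid e))
    where
    e≤n : e ≤ n
    e≤n = <⇒≤ e<n
    swap : ∀ x y z → y ∨ (x ∨ z) ≡ x ∨ (y ∨ z)
    swap true  true  z = refl
    swap true  false z = refl
    swap false y     z = refl
    low↦high : low (n ∸ e) ≡ high e
    low↦high = cong₂ _∧_ (dec-true (1 ≤? n ∸ e) (m<n⇒0<n∸m e<n))
                 (does-⇔ (mk⇔ (λ n-e≤a → ≤-trans (∸-monoʳ-≤ n n-e≤a) (≤-reflexive (m∸[m∸n]≡n e≤n)))
                               (λ n-a≤e → ≤-trans (∸-monoʳ-≤ n n-a≤e) (≤-reflexive (m∸[m∸n]≡n a≤n))))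
                         (n ∸ e ≤? a) (n ∸ a ≤? e))
    high↦low : high (n ∸ e) ≡ low e
    high↦low = trans (does-⇔ (mk⇔ (λ n-a≤n-e → ≤-trans (≤-reflexive (sym (m∸[m∸n]≡n e≤n)))
                                                  (≤-trans (∸-monoʳ-≤ n n-a≤n-e) (≤-reflexive (m∸[m∸n]≡n a≤n))))
                                  (∸-monoʳ-≤ n))
                            (n ∸ a ≤? n ∸ e) (e ≤? a))
                     (sym (cong (_∧ does (e ≤? a)) (dec-true (1 ≤? e) 1≤e)))
    mid↦mid : mid (n ∸ e) ≡ mid e
    mid↦mid = cong (c ∧_) (does-⇔ (mk⇔ (λ eq → sym (trans eq (m∸[m∸n]≡n e≤n)))
                                       (λ eq → trans (sym eq) (sym (m∸[m∸n]≡n e≤n))))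
                                  (n ∸ e ≟ℕ n ∸ (n ∸ e)) (e ≟ℕ n ∸ e))

-- First construction: the circulant graph with the interval connection set
-- is (2a + [c])-regular, giving a dominating set of size n (2a + [c]).

circulant-dominating : ∀ n a c (2a<n : a + a < n) →
  sumTo n (λ e → bit (Interval.mid n a c 2a<n e)) ≡ bit c →
  Dominating n (a + (a + bit c)) (n * (a + (a + bit c)))
circulant-dominating n a c 2a<n ∣mid∣≡c =
  graph⇒dominating n k (n * k) edge edge-loopless edge-sym
    (λ x x<n → ≤-reflexive (sym (regular x x<n)))
    (trans (sumTo-cong n regular) (sumTo-const n k))
  where
  open Interval n a c 2a<n
  open Circulant n
  open Connection conn conn-0 conn-sym
  k : ℕ
  k = a + (a + bit c)
  regular : ∀ x → x < n → sumTo n (λ y → bit (edge x y)) ≡ k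
  regular x x<n = trans (degree x x<n) (∣conn∣ (bit c) ∣mid∣≡c)

-- Second construction, for n = 2q + 1 and k = 2a′ + 1: the circulant graph of
-- degree k + 1 = 2a minus the matching {2t , 2t + 1} (t < q), which misses only
-- the vertex 2q.  Its degree sum is n (k + 1) - (n - 1) = n k + 1.

module MatchingRemoved (q a′ : ℕ) (2a<n : suc a′ + suc a′ < suc (q + q)) where
  n a k : ℕ
  n = suc (q + q)
  a = suc a′
  k = suc (a′ + a′)
  open Interval n a false 2a<n
  open Circulant n
  open Connection conn conn-0 conn-sym

  matched : ℕ → ℕ → Bool
  matched x y = (isEven x ∧ does (y ≟ℕ suc x)) ∨ (isEven y ∧ does (x ≟ℕ suc y))

  H : ℕ → ℕ → Bool
  H x y = edge x y ∧ not (matched x y)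

  conn-1 : conn 1 ≡ true
  conn-1 = cong (_∨ (high 1 ∨ mid 1)) (dec-true (1 ≤? a) (s≤s z≤n))

  sx∸x≡1 : ∀ x → suc x ∸ x ≡ 1
  sx∸x≡1 zero    = refl
  sx∸x≡1 (suc x) = sx∸x≡1 x

  -- matched vertices are at distance 1 or n - 1, hence adjacent
  matched⇒edge : ∀ x y → matched x y ≡ true → edge x y ≡ true
  matched⇒edge x y m with ∨-true {isEven x ∧ does (y ≟ℕ suc x)} m
  ... | inj₁ up with true-witness (y ≟ℕ suc x) (proj₂ (∧-true up))
  ...   | refl = trans (cong conn (trans (dist-≤ (n≤1+n x)) (sx∸x≡1 x))) conn-1
  matched⇒edge x y m | inj₂ down with true-witness (x ≟ℕ suc y) (proj₂ (∧-true down))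
  ...   | refl = trans (cong conn (trans (dist-> (n<1+n y)) (m+n∸n≡m (q + q) y)))
                       (trans (conn-sym 1 ≤-refl (≤-trans (s≤s (s≤s z≤n)) 2a<n)) conn-1)

  H-sym : ∀ x y → x < n → y < n → x ≢ y → H x y ≡ H y x
  H-sym x y x<n y<n x≢y = cong₂ _∧_ (edge-sym x y x<n y<n x≢y) (cong not (∨-comm (isEven x ∧ does (y ≟ℕ suc x)) _))

  degree-H degree-M : ℕ → ℕ
  degree-H x = sumTo n (λ y → bit (H x y))
  degree-M x = sumTo n (λ y → bit (matched x y))

  degree-H+M : ∀ x → x < n → degree-H x + degree-M x ≡ suc k
  degree-H+M x x<n = begin
    degree-H x + degree-M x                      ≡⟨ sym (sumTo-+ n (λ y → bit (H x y)) (λ y → bit (matched x y))) ⟩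
    sumTo n (λ y → bit (H x y) + bit (matched x y)) ≡⟨ sumTo-cong n (λ y _ → bit-remove (edge x y) (matched x y) (matched⇒edge x y)) ⟩
    sumTo n (λ y → bit (edge x y))               ≡⟨ degree x x<n ⟩
    sumTo n (λ e → bit (conn e))                 ≡⟨ ∣conn∣ 0 (∣mid∣-false refl) ⟩
    a + (a + 0)                                  ≡⟨ cong suc (trans (cong (a′ +_) (+-identityʳ a)) (+-suc a′ a′)) ⟩
    suc k                                        ∎
    where open ≡-Reasoning

  matched-even : ∀ x y → isEven x ≡ true → bit (matched x y) ≡ ⟦ y ≟ℕ suc x ⟧
  matched-even x y x-even = begin
    bit ((isEven x ∧ does (y ≟ℕ suc x)) ∨ (isEven y ∧ does (x ≟ℕ suc y)))
      ≡⟨ cong (λ b → bit ((b ∧ does (y ≟ℕ suc x)) ∨ (isEven y ∧ does (x ≟ℕ suc y)))) x-even ⟩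
    bit (does (y ≟ℕ suc x) ∨ (isEven y ∧ does (x ≟ℕ suc y)))
      ≡⟨ cong (λ b → bit (does (y ≟ℕ suc x) ∨ b)) not-below ⟩
    bit (does (y ≟ℕ suc x) ∨ false)
      ≡⟨ cong bit (∨-identityʳ (does (y ≟ℕ suc x))) ⟩
    ⟦ y ≟ℕ suc x ⟧ ∎
    where
    open ≡-Reasoning
    not-below : isEven y ∧ does (x ≟ℕ suc y) ≡ false
    not-below with x ≟ℕ suc y
    ... | no x≢1+y = trans (cong (isEven y ∧_) (dec-false (x ≟ℕ suc y) x≢1+y)) (∧-zeroʳ (isEven y))
    ... | yes refl = cong₂ _∧_ (trans (sym (not-involutive (isEven y))) (cong not x-even)) (dec-true (x ≟ℕ suc y) refl)

  matched-odd : ∀ x′ y → isEven x′ ≡ true → bit (matched (suc x′) y) ≡ ⟦ y ≟ℕ x′ ⟧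
  matched-odd x′ y x′-even = begin
    bit ((not (isEven x′) ∧ does (y ≟ℕ suc (suc x′))) ∨ (isEven y ∧ does (suc x′ ≟ℕ suc y)))
      ≡⟨ cong (λ b → bit ((not b ∧ does (y ≟ℕ suc (suc x′))) ∨ (isEven y ∧ does (suc x′ ≟ℕ suc y)))) x′-even ⟩
    bit (isEven y ∧ does (x′ ≟ℕ y))
      ≡⟨ below ⟩
    ⟦ y ≟ℕ x′ ⟧ ∎
    where
    open ≡-Reasoning
    below : bit (isEven y ∧ does (x′ ≟ℕ y)) ≡ ⟦ y ≟ℕ x′ ⟧
    below with x′ ≟ℕ y
    ... | yes refl = cong bit (trans (cong₂ _∧_ x′-even (dec-true (x′ ≟ℕ x′) refl)) (sym (dec-true (x′ ≟ℕ x′) refl)))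
    ... | no x′≢y  = cong bit (trans (trans (cong (isEven y ∧_) (dec-false (x′ ≟ℕ y) x′≢y)) (∧-zeroʳ (isEven y)))
                                     (sym (dec-false (y ≟ℕ x′) (λ y≡x′ → x′≢y (sym y≡x′)))))

  degree-M-even : ∀ x → x < n → isEven x ≡ true → degree-M x + ⟦ x ≟ℕ q + q ⟧ ≡ 1
  degree-M-even x x<n x-even =
    trans (cong (_+ ⟦ x ≟ℕ q + q ⟧) (trans (sumTo-cong n (λ y _ → matched-even x y x-even)) (sumTo-≡ n (suc x)))) last-or-not
    where
    last-or-not : ⟦ suc x <? n ⟧ + ⟦ x ≟ℕ q + q ⟧ ≡ 1
    last-or-not with suc x <? n
    ... | yes 1+x<n = cong₂ _+_ (cong bit (dec-true (suc x <? n) 1+x<n))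
                               (cong bit (dec-false (x ≟ℕ q + q) (λ x≡2q → 1+n≰n (≤-trans (s≤s (≤-reflexive (cong suc (sym x≡2q)))) 1+x<n))))
    ... | no 1+x≮n  = cong₂ _+_ (cong bit (dec-false (suc x <? n) 1+x≮n))
                               (cong bit (dec-true (x ≟ℕ q + q) (suc-injective (≤-antisym x<n (≮⇒≥ 1+x≮n)))))

  degree-M-odd : ∀ x′ → suc x′ < n → isEven x′ ≡ true → degree-M (suc x′) + ⟦ suc x′ ≟ℕ q + q ⟧ ≡ 1
  degree-M-odd x′ 1+x′<n x′-even =
    cong₂ _+_ (trans (sumTo-cong n (λ y _ → matched-odd x′ y x′-even))
                     (trans (sumTo-≡ n x′) (cong bit (dec-true (x′ <? n) (<-trans (n<1+n x′) 1+x′<n)))))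
              (cong bit (dec-false (suc x′ ≟ℕ q + q) 1+x′≢2q))
    where
    1+x′≢2q : suc x′ ≢ q + q
    1+x′≢2q 1+x′≡2q with trans (sym (cong not x′-even)) (trans (cong isEven 1+x′≡2q) (isEven-double q))
    ... | ()

  degree-M+last : ∀ x → x < n → degree-M x + ⟦ x ≟ℕ q + q ⟧ ≡ 1
  degree-M+last zero     0<n = degree-M-even zero 0<n refl
  degree-M+last (suc x′) x<n = by-parity (isEven x′) refl
    where
    by-parity : ∀ b → isEven x′ ≡ b → degree-M (suc x′) + ⟦ suc x′ ≟ℕ q + q ⟧ ≡ 1
    by-parity true  x′-even = degree-M-odd x′ x<n x′-even
    by-parity false x′-odd  = degree-M-even (suc x′) x<n (cong not x′-odd)

  ∑degree-H+M : sumTo n degree-H + sumTo n degree-M ≡ n * suc k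
  ∑degree-H+M = trans (sym (sumTo-+ n degree-H degree-M)) (trans (sumTo-cong n degree-H+M) (sumTo-const n (suc k)))

  ∑degree-M : sumTo n degree-M + 1 ≡ n
  ∑degree-M = begin
    sumTo n degree-M + 1                                           ≡⟨ cong (sumTo n degree-M +_) (sym one-last) ⟩
    sumTo n degree-M + sumTo n (λ x → ⟦ x ≟ℕ q + q ⟧)              ≡⟨ sym (sumTo-+ n degree-M (λ x → ⟦ x ≟ℕ q + q ⟧)) ⟩
    sumTo n (λ x → degree-M x + ⟦ x ≟ℕ q + q ⟧)                    ≡⟨ sumTo-cong n degree-M+last ⟩
    sumTo n (λ _ → 1)                                              ≡⟨ trans (sumTo-const n 1) (*-identityʳ n) ⟩
    n                                                              ∎
    where
    open ≡-Reasoning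
    one-last : sumTo n (λ x → ⟦ x ≟ℕ q + q ⟧) ≡ 1
    one-last = trans (sumTo-≡ n (q + q)) (cong bit (dec-true (q + q <? n) ≤-refl))

  ∑degree-H : sumTo n degree-H ≡ n * k + 1
  ∑degree-H = +-cancelʳ-≡ (sumTo n degree-M) _ _ (begin
    sumTo n degree-H + sumTo n degree-M        ≡⟨ ∑degree-H+M ⟩
    n * suc k                                  ≡⟨ *-suc n k ⟩
    n + n * k                                  ≡⟨ cong (_+ n * k) (sym ∑degree-M) ⟩
    (sumTo n degree-M + 1) + n * k             ≡⟨ +-comm (sumTo n degree-M + 1) (n * k) ⟩
    n * k + (sumTo n degree-M + 1)             ≡⟨ cong (n * k +_) (+-comm (sumTo n degree-M) 1) ⟩
    n * k + (1 + sumTo n degree-M)             ≡⟨ sym (+-assoc (n * k) 1 (sumTo n degree-M)) ⟩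
    n * k + 1 + sumTo n degree-M               ∎)
    where open ≡-Reasoning

  min-degree-H : ∀ x → x < n → k ≤ degree-H x
  min-degree-H x x<n = +-cancelʳ-≤ 1 k (degree-H x) (begin
    k + 1                        ≡⟨ +-comm k 1 ⟩
    suc k                        ≡⟨ sym (degree-H+M x x<n) ⟩
    degree-H x + degree-M x      ≤⟨ +-monoʳ-≤ (degree-H x) (m+n≤o⇒m≤o (degree-M x) (≤-reflexive (degree-M+last x x<n))) ⟩
    degree-H x + 1               ∎)
    where open ≤-Reasoning

  dominating : Dominating n k (n * k + 1)
  dominating = graph⇒dominating n k (n * k + 1) H
    (λ x → cong (_∧ not (matched x x)) (edge-loopless x)) H-sym min-degree-H ∑degree-H

halves-< : ∀ {u v} → u + u < v + v → u < v
halves-< {u} {v} 2u<2v = ≰⇒> (λ v≤u → <⇒≱ 2u<2v (+-mono-≤ v≤u v≤u))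

-- Upper bound n k, unless n and k are both odd: the circulant construction
-- with k = 2a, or with k = 2a + 1 and n = 2b even (the extra residue b).
upper-bound-nk : ∀ n k → k < n → ¬ (Odd k × Odd n) → Dominating n k (n * k)
upper-bound-nk n k k<n not-both with parity k
... | even a = subst (λ z → Dominating n z (n * z)) (cong (a +_) (+-identityʳ a))
                 (circulant-dominating n a false k<n (Interval.∣mid∣-false n a false k<n refl))
... | odd a with parity n
...   | odd q  = ⊥-elim (not-both (Odd-1+double a , Odd-1+double q))
...   | even b = subst (λ z → Dominating (b + b) z ((b + b) * z)) (trans (cong (a +_) (+-comm a 1)) (+-suc a a))
                   (circulant-dominating (b + b) a true 2a<n (Interval.∣mid∣-true (b + b) a true 2a<n refl b refl))
  where
  2a<n : a + a < b + b
  2a<n = <-trans (n<1+n (a + a)) k<n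

upper-bound-nk+1 : ∀ n k → k < n → Odd k → Odd n → Dominating n k (n * k + 1)
upper-bound-nk+1 n k k<n k-odd n-odd with parity k | parity n
... | even a | _      = ⊥-elim (¬Odd-double a k-odd)
... | odd a  | even b = ⊥-elim (¬Odd-double b n-odd)
... | odd a  | odd q  = MatchingRemoved.dominating q a (s≤s (+-mono-≤ a<q a<q))
  where
  a<q : a < q
  a<q = halves-< (≤-pred k<n)

proposition3p3 : ∀ (n k : ℕ) → 2 ≤ k → k < n →
    KHamLikeDecomposable (K n) ((n ∸ 1) / 2) ×
    ((Odd k × Odd n → KTupleTotalDomNumber≡ (Inflated (K n) _≟_) k (n * k + 1)) ×
     (¬ (Odd k × Odd n) → KTupleTotalDomNumber≡ (Inflated (K n) _≟_) k (n * k)))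
proposition3p3 zero                k 2≤k ()
proposition3p3 (suc zero)          k 2≤k k<1 = ⊥-elim (<⇒≱ k<1 (≤-trans (s≤s z≤n) 2≤k))
proposition3p3 (suc (suc zero))    k 2≤k k<2 = ⊥-elim (<⇒≱ k<2 2≤k)
proposition3p3 n@(suc (suc (suc m))) k 2≤k k<n =
  Walecki.decomposable (suc m) (s≤s z≤n) ,
  (λ (k-odd , n-odd) → upper-bound-nk+1 n k k<n k-odd n-odd , lower-bound-nk+1 (2 + m) (three-vertices m) k k-odd n-odd) ,
  (λ not-both → upper-bound-nk n k k<n not-both , lower-bound-nk (2 + m) k)
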